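{- Let $\mathcal{P}=(\mathcal{PV},\mathcal{L},\ell_0,\mathcal{T})$ be an integer program and $\mathcal{C}=\{t_1,\ldots,t_n\}\subset\mathcal{T}$ a simple cycle with $t_k=(\ell_k,\_,\_,\ell_{k+1})$ for $1\le k\le n-1$ and $t_n=(\ell_n,\_,\_,\ell_1)$. Define ${\mathcal{RB}_{\text{loc}}}:\mathcal{E}_{\mathcal{C}}\to\mathcal{B}$ as follows (this is the output of the algorithm). For $r\in\mathcal{E}_{\mathcal{C}}$, let $i$ be such that the target location of $r$ is $\ell_i$, and let $t=t_i\star\cdots\star t_n\star t_1\star\cdots\star t_{i-1}=(\ell_i,\varphi,\eta,\ell_i)$. If there is a bijective renaming $\pi$ of $\mathcal{PV}$ and a subset $\mathcal{PV}'=\{x_1,\ldots,x_d\}\subseteq\mathcal{PV}$ such that the renamed transition $\pi(t)=(\ell_i,\varphi_\pi,\eta_\pi,\ell_i)$ satisfies $\varphi_\pi\in\mathcal{F}(\mathcal{PV}')$, $\eta_\pi(x_k)=c_kx_k+p_k$ with $c_k\in\mathbb{Z}$ and $p_k\in\mathbb{Z}[x_{k+1},\ldots,x_d]$ for $1\le k\le d$, and $\eta_\pi(v)=v$ for $v\in\mathcal{PV}\setminus\mathcal{PV}'$, then choose $\psi\in\mathcal{F}(\mathcal{PV}')$ with $\models\psi\to\eta_\pi(\psi)$ such that $\sigma(\pi^{ -1}(\psi))$ holds whenever $(\ell_0,\sigma_0)\to^*_{\mathcal{T}}\circ\to_r(\ell_i,\sigma)$ for some $\sigma_0$ (where $\pi^{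 -1}(\psi)$ renames each variable $x$ to $\pi^{ -1}(x)$), let $L=(\psi,\varphi_\pi,\eta_\pi|_{\mathcal{PV}'})$, and set ${\mathcal{RB}_{\text{loc}}}(r)=\pi^{ -1}(1+B)$, where $B={\operatorname{sth}^{\sqcup}}$ for a stabilization bound polynomial ${\operatorname{sth}^{\sqcup}}$ of $L$ if $L$ is a terminating tnn-loop, $B=2\cdot{\operatorname{sth}^{\sqcup}}+1$ for a stabilization bound polynomial ${\operatorname{sth}^{\sqcup}}$ of $L\star L$ if $L$ is a terminating twn-loop but not a tnn-loop, and $B=\omega$ otherwise; if no such $\pi$ exists, set ${\mathcal{RB}_{\text{loc}}}(r)=\omega$. Then ${\mathcal{RB}_{\text{loc}}}$ is a local runtime bound for $\mathcal{C}=\mathcal{T}'_>=\mathcal{T}'$ in $\mathcal{P}$.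
   Context: Integer programs: $\mathcal{F}(\mathcal{V})$ are propositional formulas ($\land,\lor$) over atoms $q_1<q_2$, $q_i\in\mathbb{Z}[\mathcal{V}]$. An integer program $(\mathcal{PV},\mathcal{L},\ell_0,\mathcal{T})$ has a finite set $\mathcal{PV}\subseteq\mathcal{V}$ of program variables (others are temporary), finite locations $\mathcal{L}$ with initial $\ell_0$, and finite transitions $(\ell,\varphi,\eta,\ell')$ with $\ell'\neq\ell_0$, guard $\varphi\in\mathcal{F}(\mathcal{V})$, update $\eta:\mathcal{PV}\to\mathbb{Z}[\mathcal{V}]$. States are $\sigma:\mathcal{V}\to\mathbb{Z}$; $|\sigma|(v)=|\sigma(v)|$; $(\ell,\sigma)\to_s(\ell',\sigma')$ for $s=(\ell,\varphi,\eta,\ell')$ iff $\sigma(\varphi)$ holds and $\sigma'(v)=\sigma(\eta(v))$ for $v\in\mathcal{PV}$; $\to_{\mathcal{T}}$ is the union over $\mathcal{T}$, $\to^*$ reflexive-transitive closure. Bounds $\mathcal{B}$: smallest set containing $\mathbb{N}\cup\{\omega\}$ and $\mathcal{PV}$, closed under $+,\cdot$, $k^b$ ($k\in\mathbb{N}$). $\mathcal{E}_{\mathcal{T}'}$: transitions in $\mathcal{T}\setminus\mathcal{T}'$ whose target is the start location of a transition of $\mathcal{T}'$. A local runtime bound for $\mathcal{T}'_>$ w.r.t. $\mathcal{T}'$ is ${\mathcal{RB}_{\text{loc}}}:\mathcal{E}_{\mathcal{T}'}\to\mathcal{B}$ with $|\sigma|({\mathcal{RB}_{\text{loc}}}(r))\ge\sup\{k\mid\exists\sigma_0,\ell'',(\ell',\sigma').\,(\ell_0,\sigma_0)\to^*_{\mathcal{T}}\circ\to_r(\ell'',\sigma)(\to^*_{\mathcal{T}'}\circ\to_s)^k(\ell',\sigma')\}$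 for all $s\in\mathcal{T}'_>$, $r\in\mathcal{E}_{\mathcal{T}'}$, states $\sigma$. Simple cycle: $\mathcal{C}=\{t_1,\ldots,t_n\}$ contains no temporary variables and there are pairwise different locations $\ell_1,\ldots,\ell_n$ with $t_k$ going from $\ell_k$ to $\ell_{k+1}$ ($k<n$) and $t_n$ from $\ell_n$ to $\ell_1$. Chaining of $s_1,\ldots,s_m$ with $s_k=(\ell_k,\varphi_k,\eta_k,\ell_{k+1})$: $s_1\star\cdots\star s_m=(\ell_1,\varphi,\eta,\ell_{m+1})$ with $\varphi=\varphi_1\land\eta_1(\varphi_2)\land\eta_2(\eta_1(\varphi_3))\land\cdots\land\eta_{m-1}(\cdots\eta_1(\varphi_m)\cdots)$ and $\eta=\eta_m\circ\cdots\circ\eta_1$ (applying an update to a formula substitutes $\eta(v)$ for each $v$). Twn-loops: $(\psi,\varphi,\eta)$ over $\{x_1,\ldots,x_d\}$ is the program with transitions $(\ell_0,\psi,\mathrm{id},\ell)$ and $(\ell,\varphi,\eta,\ell)$, with $\models\psi\to\eta(\psi)$ and $\eta(x_k)=c_kx_k+p_k$, $c_k\in\mathbb{Z}$, $p_k\in\mathbb{Z}[x_{k+1},\ldots,x_d]$; tnn-loop if all $c_k\ge0$; terminating if it has no infinite evaluation. $L\star L$ for $L=(\psi,\varphi,\eta)$ is $(\psi,\varphi\land\eta(\varphi),\eta\circ\eta)$. Stabilization bound polynomial of a terminating tnn-loop $L=(\psi,\varphi,\eta)$: let $\psi'=\psi\land\varphi$, $\Psi'=\{\vec e\in\mathbb{Z}^d\mid\sigma_{\vec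 e}(\psi')\}$ with $\sigma_{\vec e}(x_k)=e_k$. Take a normalized closed form $\overline{\vec x}$ of $\eta$ with start value $n_0$ (expressions over $\vec x$ and $n$ with $\sigma(\overline{x_k})=\sigma(\eta^n(x_k))$ whenever $\sigma(n)\ge n_0$) whose components have the form $\sum_j p_jn^{a_j}b_j^n$, $p_j\in\mathbb{Q}[\vec x]$, $a_j\in\mathbb{N}$, $b_j\in\mathbb{N}_{\ge1}$. For each atom $\alpha=(s_1<s_2)$ of $\varphi$, $npe_\alpha$ is $(s_2-s_1)[\vec x/\overline{\vec x}]$ multiplied by the lcm of its denominators, written $\sum_{(p,a,b)\in\Lambda}p\,n^ab^n$ with monomials $p$. Choose disjoint $\Delta,\Gamma\subseteq\Lambda$ with $\models\psi'\to p>0$ on $\Delta$, $\models\psi'\to p\le0$ on $\Gamma$, and $i_{(p,a,b)},j_{(p,a,b)}\in\mathbb{N}$ with $(j,i)>_{\mathrm{lex}}(b,a)$ on $\Delta$, $(b,a)>_{\mathrm{lex}}(j,i)$ on $\Gamma$; set $\overline{npe_\alpha}=\sum_{\Delta\cup\Gamma}p\,n^ij^n+\sum_{\Lambda\setminus(\Delta\cup\Gamma)}p\,n^ab^n$, required to be eventually non-positive (if $\overline{npe_\alpha}\neq npe_\alpha$, then for each $\vec e\in\Psi'$, $\sigma_{\vec e}(\overline{npe_\alpha})\le0$ for all large $n$). The $k$-monotonicity threshold of $(b_1,a_1)>_{\mathrm{lex}}(b_2,a_2)$ is the least $n_0$ with $n^{a_1}b_1^n>k\,n^{a_2}b_2^n$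 for all $n\ge n_0$. $D_\alpha$ is the max ($\max\emptyset=0$) of the 1-monotonicity thresholds of $(j,i),(b,a)$ over $\Delta$ and $(b,a),(j,i)$ over $\Gamma$. Write $\overline{npe_\alpha}=\sum_{j=1}^{\ell}p_jn^{a_j}b_j^n$ with $p_j\neq0$, $(b_\ell,a_\ell)>_{\mathrm{lex}}\cdots>_{\mathrm{lex}}(b_1,a_1)$; $C_\alpha=\max\{1,N_2,M_2,\ldots,N_\ell,M_\ell\}$ with $M_j=0$ if $b_j=b_{j-1}$, else the 1-monotonicity threshold of $(b_j,a_j)$ and $(b_{j-1},a_{j-1}+1)$; $N_2=1$, $N_3=mt'$, $N_j=\max\{mt,mt'\}$ ($j>3$), $mt'$ the $(j-2)$-monotonicity threshold of $(b_{j-1},a_{j-1})$ and $(b_{j-2},a_{j-2})$, $mt$ the max of the 1-monotonicity thresholds of $(b_{j-2},a_{j-2})$ and $(b_i,a_i)$, $1\le i\le j-3$. With $Pol=\bigcup_\alpha\{p_1,\ldots,p_{\ell-1}\}$, $C=\max_\alpha C_\alpha$, $D=\max_\alpha D_\alpha$, the polynomial is $2\cdot\sqcup Pol+\max\{n_0,C,D\}$, where $\sqcup\{q_1,\ldots,q_m\}=\sum_{\vec e}c_{\vec e}\vec x^{\vec e}$ with $c_{\vec e}$ the maximal absolute coefficient of $\vec x^{\vec e}$ among the $q_k$ ($0$ if none). -}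

module Defs where

open import Data.Nat as ℕ using (ℕ; zero; suc; _∸_; _⊔_)
open import Data.Nat.LCM using (lcm)
open import Data.Integer as ℤ using (ℤ; +_; -[1+_])
open import Data.Rational as ℚ using (ℚ; ↧ₙ_)
open import Data.Fin as Fin using (Fin; toℕ; fromℕ<)
open import Data.Fin.Permutation using (Permutation′; _⟨$⟩ʳ_; _⟨$⟩ˡ_)
open import Data.Vec as Vec using (Vec; []; _∷_; lookup)
import Data.Vec.Properties as VecP
open import Data.List as List using (List; []; _∷_; _++_; map; foldr; length; upTo; take; zipWith; concatMap; filter; deduplicate)
open import Data.List.Membership.Propositional using (_∈_)
open import Data.List.Relation.Unary.All using (All)
open import Data.List.Relation.Unary.Any using (Any)
open import Data.List.Relation.Unary.Unique.Propositional using (Unique)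
open import Data.List.Relation.Unary.Linked using (Linked)
open import Data.List.Relation.Binary.Pointwise using (Pointwise)
open import Data.Maybe using (Maybe; just; nothing)
open import Data.Product using (Σ; ∃; ∃-syntax; _×_; _,_; proj₁; proj₂)
open import Data.Sum using (_⊎_; inj₁; inj₂)
open import Data.Unit using (⊤)
open import Data.Empty using (⊥)
open import Data.Bool using (if_then_else_)
open import Function using (_∘_)
open import Function.Definitions using (Injective)
open import Relation.Nullary using (¬_; yes; no)
open import Relation.Binary.PropositionalEquality using (_≡_; _≢_)
open import Relation.Binary.Construct.Closure.ReflexiveTransitive using (Star)

-- Polynomials ℤ[V] (syntax; equality of polynomials is taken semantically)

data Poly (V : Set) : Set where
  pc   : ℤ → Poly V
  pv   : V → Poly V
  _p+_ : Poly V → Poly V → Poly V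
  _p*_ : Poly V → Poly V → Poly V

psub : ∀ {V} → Poly V → Poly V → Poly V
psub p q = p p+ (pc (ℤ.- (+ 1)) p* q)

mapP : ∀ {V W : Set} → (V → W) → Poly V → Poly W
mapP f (pc c) = pc c
mapP f (pv v) = pv (f v)
mapP f (p p+ q) = mapP f p p+ mapP f q
mapP f (p p* q) = mapP f p p* mapP f q

substP : ∀ {V W : Set} → (V → Poly W) → Poly V → Poly W
substP f (pc c) = pc c
substP f (pv v) = f v
substP f (p p+ q) = substP f p p+ substP f q
substP f (p p* q) = substP f p p* substP f q

evalP : ∀ {V : Set} → (V → ℤ) → Poly V → ℤ
evalP σ (pc c) = c
evalP σ (pv v) = σ v
evalP σ (p p+ q) = evalP σ p ℤ.+ evalP σ q
evalP σ (p p* q) = evalP σ p ℤ.* evalP σ q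

toQ : ℤ → ℚ
toQ z = z ℚ./ 1

evalPQ : ∀ {V : Set} → (V → ℚ) → Poly V → ℚ
evalPQ σ (pc c) = toQ c
evalPQ σ (pv v) = σ v
evalPQ σ (p p+ q) = evalPQ σ p ℚ.+ evalPQ σ q
evalPQ σ (p p* q) = evalPQ σ p ℚ.* evalPQ σ q

PolyEq : ∀ {V : Set} → Poly V → Poly V → Set
PolyEq p q = ∀ σ → evalP σ p ≡ evalP σ q

data Form (V : Set) : Set where
  _f<_ : Poly V → Poly V → Form V
  _f∧_ : Form V → Form V → Form V
  _f∨_ : Form V → Form V → Form V

mapF : ∀ {V W : Set} → (V → W) → Form V → Form W
mapF f (p f< q) = mapP f p f< mapP f q
mapF f (φ f∧ ψ) = mapF f φ f∧ mapF f ψ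
mapF f (φ f∨ ψ) = mapF f φ f∨ mapF f ψ

substF : ∀ {V W : Set} → (V → Poly W) → Form V → Form W
substF f (p f< q) = substP f p f< substP f q
substF f (φ f∧ ψ) = substF f φ f∧ substF f ψ
substF f (φ f∨ ψ) = substF f φ f∨ substF f ψ

holds : ∀ {V : Set} → (V → ℤ) → Form V → Set
holds σ (p f< q) = evalP σ p ℤ.< evalP σ q
holds σ (φ f∧ ψ) = holds σ φ × holds σ ψ
holds σ (φ f∨ ψ) = holds σ φ ⊎ holds σ ψ

atoms : ∀ {V : Set} → Form V → List (Poly V × Poly V)
atoms (p f< q) = (p , q) ∷ []
atoms (φ f∧ ψ) = atoms φ ++ atoms ψ
atoms (φ f∨ ψ) = atoms φ ++ atoms ψ

FormEq : ∀ {V : Set} → Form V → Form V → Set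
FormEq (p f< q) (p' f< q') = PolyEq p p' × PolyEq q q'
FormEq (φ f∧ ψ) (φ' f∧ ψ') = FormEq φ φ' × FormEq ψ ψ'
FormEq (φ f∨ ψ) (φ' f∨ ψ') = FormEq φ φ' × FormEq ψ ψ'
FormEq _ _ = ⊥

-- Integer programs.  Variables 𝒱 = Fin m ⊎ ℕ : inj₁ = the m program
-- variables PV, inj₂ = (infinitely many) temporary variables.

Var : ℕ → Set
Var m = Fin m ⊎ ℕ

record Trans (m nL : ℕ) : Set where
  constructor trans
  field
    src   : Fin nL
    guard : Form (Var m)
    upd   : Fin m → Poly (Var m)
    tgt   : Fin nL
open Trans public

record Program : Set where
  field
    m    : ℕ
    nL   : ℕ
    ℓ₀   : Fin nL
    T    : List (Trans m nL)
    tgt≢ℓ₀ : All (λ t → tgt t ≢ ℓ₀) T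
open Program public

State : ℕ → Set
State m = Var m → ℤ

Config : ℕ → ℕ → Set
Config m nL = Fin nL × State m

StepVia : ∀ {m nL} → Trans m nL → Config m nL → Config m nL → Set
StepVia s (ℓ , σ) (ℓ' , σ') =
  src s ≡ ℓ × tgt s ≡ ℓ' × holds σ (guard s) × (∀ v → σ' (inj₁ v) ≡ evalP σ (upd s v))

StepT : ∀ {m nL} → List (Trans m nL) → Config m nL → Config m nL → Set
StepT T c c' = ∃[ s ] (s ∈ T × StepVia s c c')

Terminating : Program → Set
Terminating P =
  ¬ (Σ (ℕ → Config (m P) (nL P)) λ f →
       (proj₁ (f 0) ≡ ℓ₀ P) × (∀ n → StepT (T P) (f n) (f (suc n))))

ReachVia : (P : Program) → Trans (m P) (nL P) → State (m P) → Fin (nL P) → State (m P) → Set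
ReachVia P r σ₀ ℓ'' σ = ∃[ c ] (Star (StepT (T P)) (ℓ₀ P , σ₀) c × StepVia r c (ℓ'' , σ))

RelPow : ∀ {A : Set} → (A → A → Set) → ℕ → A → A → Set
RelPow R zero x y = x ≡ y
RelPow R (suc k) x y = ∃[ z ] (RelPow R k x z × R z y)

updSubst : ∀ {m} → (Fin m → Poly (Var m)) → Var m → Poly (Var m)
updSubst η (inj₁ v) = η v
updSubst η (inj₂ t) = pv (inj₂ t)

_⋆_ : ∀ {m nL} → Trans m nL → Trans m nL → Trans m nL
s₁ ⋆ s₂ = trans (src s₁)
                (guard s₁ f∧ substF (updSubst (upd s₁)) (guard s₂))
                (λ v → substP (updSubst (upd s₁)) (upd s₂ v))
                (tgt s₂)

chain : ∀ {m nL} → Trans m nL → List (Trans m nL) → Trans m nL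
chain t [] = t
chain t (u ∷ us) = t ⋆ chain u us

NoTempP : ∀ {m} → Poly (Var m) → Set
NoTempP p = ∀ σ σ' → (∀ v → σ (inj₁ v) ≡ σ' (inj₁ v)) → evalP σ p ≡ evalP σ' p

NoTempT : ∀ {m nL} → Trans m nL → Set
NoTempT t = All (λ a → NoTempP (proj₁ a) × NoTempP (proj₂ a)) (atoms (guard t))
          × (∀ v → NoTempP (upd t v))

next : ∀ {n} → Fin (suc n) → Fin (suc n)
next {n} k with suc (toℕ k) ℕ.<? suc n
... | yes p = fromℕ< p
... | no _  = Fin.zero

iter : ∀ {A : Set} → ℕ → (A → A) → A → A
iter zero f a = a
iter (suc k) f a = f (iter k f a)

record SimpleCycle (P : Program) : Set where
  field
    n      : ℕ                              -- the cycle has suc n transitions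
    t      : Fin (suc n) → Trans (m P) (nL P)
    ℓ      : Fin (suc n) → Fin (nL P)
    ℓ-inj  : Injective _≡_ _≡_ ℓ
    t-src  : ∀ k → src (t k) ≡ ℓ k
    t-tgt  : ∀ k → tgt (t k) ≡ ℓ (next k)
    t∈T    : ∀ k → t k ∈ T P
    noTemp : ∀ k → NoTempT (t k)

  -- t_i ⋆ ⋯ ⋆ t_n ⋆ t_1 ⋆ ⋯ ⋆ t_{i-1}
  cycleFrom : Fin (suc n) → Trans (m P) (nL P)
  cycleFrom i = chain (t i) (map (λ j → t (iter j next i)) (map suc (upTo n)))

record InE (P : Program) (C : SimpleCycle P) (r : Trans (m P) (nL P)) : Set where
  open SimpleCycle C
  field
    r∈T  : r ∈ T P
    r∉C  : ∀ k → r ≢ t k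
    i    : Fin (suc n)
    r-tgt : tgt r ≡ ℓ i

-- Bounds 𝓑 and their evaluation in ℕ ∪ {ω} (nothing = ω)

data Bound (V : Set) : Set where
  bn   : ℕ → Bound V
  bω   : Bound V
  bv   : V → Bound V
  _b+_ : Bound V → Bound V → Bound V
  _b*_ : Bound V → Bound V → Bound V
  bexp : ℕ → Bound V → Bound V

mapB : ∀ {V W : Set} → (V → W) → Bound V → Bound W
mapB f (bn k) = bn k
mapB f bω = bω
mapB f (bv v) = bv (f v)
mapB f (a b+ b) = mapB f a b+ mapB f b
mapB f (a b* b) = mapB f a b* mapB f b
mapB f (bexp k b) = bexp k (mapB f b)

lift2 : (ℕ → ℕ → ℕ) → Maybe ℕ → Maybe ℕ → Maybe ℕ
lift2 f (just a) (just b) = just (f a b)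
lift2 f _ _ = nothing

evalB : ∀ {V : Set} → (V → ℕ) → Bound V → Maybe ℕ
evalB ρ (bn k) = just k
evalB ρ bω = nothing
evalB ρ (bv v) = just (ρ v)
evalB ρ (a b+ b) = lift2 ℕ._+_ (evalB ρ a) (evalB ρ b)
evalB ρ (a b* b) = lift2 ℕ._*_ (evalB ρ a) (evalB ρ b)
evalB ρ (bexp k b) with evalB ρ b
... | just e = just (k ℕ.^ e)
... | nothing = nothing

data _≤∞_ (k : ℕ) : Maybe ℕ → Set where
  ≤ω : k ≤∞ nothing
  ≤j : ∀ {b} → k ℕ.≤ b → k ≤∞ just b

IsLocalBound : (P : Program) (C : SimpleCycle P) → Trans (m P) (nL P) → Bound (Fin (m P)) → Set
IsLocalBound P C r b =
  ∀ (j : Fin (suc n)) (σ₀ : State (m P)) (ℓ'' : Fin (nL P)) (σ : State (m P))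
    (ℓ' : Fin (nL P)) (σ' : State (m P)) (k : ℕ) →
  ReachVia P r σ₀ ℓ'' σ →
  RelPow (λ c c' → ∃[ c'' ] (Star StepC c c'' × StepVia (t j) c'' c')) k (ℓ'' , σ) (ℓ' , σ') →
  k ≤∞ evalB (λ v → ℤ.∣ σ (inj₁ v) ∣) b
  where
    open SimpleCycle C
    StepC : Config (m P) (nL P) → Config (m P) (nL P) → Set
    StepC c c' = ∃[ q ] StepVia (t q) c c'

-- twn-loops (ψ, φ, η) over x₁ … x_d  (x_k = k : Fin d)

record TLoop (d : ℕ) : Set where
  constructor tloop
  field
    pre   : Form (Fin d)
    guard : Form (Fin d)
    upd   : Fin d → Poly (Fin d)

loopProgram : ∀ {d} → TLoop d → Program
loopProgram {d} L = record
  { m = d ; nL = 2 ; ℓ₀ = Fin.zero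
  ; T = trans Fin.zero (mapF inj₁ (TLoop.pre L)) (λ v → pv (inj₁ v)) (Fin.suc Fin.zero)
      ∷ trans (Fin.suc Fin.zero) (mapF inj₁ (TLoop.guard L)) (λ v → mapP inj₁ (TLoop.upd L v)) (Fin.suc Fin.zero)
      ∷ []
  ; tgt≢ℓ₀ = (λ ()) All.∷ (λ ()) All.∷ All.[] }
  where import Data.List.Relation.Unary.All as All

_⋆L_ : ∀ {d} → TLoop d → TLoop d → TLoop d
L ⋆L _ = tloop (TLoop.pre L)
               (TLoop.guard L f∧ substF (TLoop.upd L) (TLoop.guard L))
               (λ k → substP (TLoop.upd L) (TLoop.upd L k))

monoZ : ∀ {d} → (Fin d → ℤ) → Vec ℕ d → ℤ
monoZ x [] = + 1
monoZ x (e ∷ es) = (x Fin.zero ℤ.^ e) ℤ.* monoZ (x ∘ Fin.suc) es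

powQ : ℚ → ℕ → ℚ
powQ q zero = ℚ.1ℚ
powQ q (suc k) = q ℚ.* powQ q k

monoQ : ∀ {d} → (Fin d → ℚ) → Vec ℕ d → ℚ
monoQ x [] = ℚ.1ℚ
monoQ x (e ∷ es) = powQ (x Fin.zero) e ℚ.* monoQ (x ∘ Fin.suc) es

powB : ∀ {V : Set} → Bound V → ℕ → Bound V
powB b zero = bn 1
powB b (suc k) = b b* powB b k

monoB : ∀ {d} → Vec ℕ d → Bound (Fin d)
monoB [] = bn 1
monoB (e ∷ es) = powB (bv Fin.zero) e b* mapB Fin.suc (monoB es)

sumQ : List ℚ → ℚ
sumQ = foldr ℚ._+_ ℚ.0ℚ

sumZ : List ℤ → ℤ
sumZ = foldr ℤ._+_ (+ 0)

maxL : ℕ → List ℕ → ℕ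
maxL z = foldr _⊔_ z

nab : ℕ → ℕ → ℕ → ℕ
nab n a b = (n ℕ.^ a) ℕ.* (b ℕ.^ n)

-- polynomials with rational / integer coefficients as lists of monomials
QPoly : ℕ → Set
QPoly d = List (ℚ × Vec ℕ d)

ZPoly : ℕ → Set
ZPoly d = List (ℤ × Vec ℕ d)

evalQP : ∀ {d} → (Fin d → ℤ) → QPoly d → ℚ
evalQP x p = sumQ (map (λ m → proj₁ m ℚ.* monoQ (toQ ∘ x) (proj₂ m)) p)

evalZP : ∀ {d} → (Fin d → ℤ) → ZPoly d → ℤ
evalZP x p = sumZ (map (λ m → proj₁ m ℤ.* monoZ x (proj₂ m)) p)

-- closed-form components: Σ_j p_j n^{a_j} b_j^n, entries (p_j , a_j , b_j)
CFTerm : ℕ → Set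
CFTerm d = QPoly d × ℕ × ℕ

evalCF : ∀ {d} → (Fin d → ℤ) → ℕ → List (CFTerm d) → ℚ
evalCF x n ts = sumQ (map (λ { (p , a , b) → evalQP x p ℚ.* toQ (+ nab n a b) }) ts)

iterUpd : ∀ {d} → (Fin d → Poly (Fin d)) → ℕ → (Fin d → ℤ) → (Fin d → ℤ)
iterUpd η zero x = x
iterUpd η (suc n) x = λ k → evalP (iterUpd η n x) (η k)

IsClosedForm : ∀ {d} → (Fin d → Poly (Fin d)) → (Fin d → List (CFTerm d)) → ℕ → Set
IsClosedForm η cf n₀ =
  (∀ k → All (λ t → 1 ℕ.≤ proj₂ (proj₂ t)) (cf k)) ×
  (∀ x n → n₀ ℕ.≤ n → ∀ k → evalCF x n (cf k) ≡ toQ (iterUpd η n x k))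

-- keys (e , a , b) of terms  x^e n^a b^n
Key : ℕ → Set
Key d = Vec ℕ d × ℕ × ℕ

termQ : ∀ {d} → (Fin d → ℤ) → ℕ → ℚ × Key d → ℚ
termQ x n (q , e , a , b) = q ℚ.* monoQ (toQ ∘ x) e ℚ.* toQ (+ nab n a b)

termZ : ∀ {d} → (Fin d → ℤ) → ℕ → ℤ × Key d → ℤ
termZ x n (c , e , a , b) = c ℤ.* monoZ x e ℤ.* (+ nab n a b)

npeVal : ∀ {d} → Poly (Fin d) × Poly (Fin d) → (Fin d → List (CFTerm d)) → (Fin d → ℤ) → ℕ → ℚ
npeVal (s₁ , s₂) cf x n = evalPQ (λ k → evalCF x n (cf k)) (psub s₂ s₁)

_>lex_ : ℕ × ℕ → ℕ × ℕ → Set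
(b₁ , a₁) >lex (b₂ , a₂) = (b₂ ℕ.< b₁) ⊎ (b₁ ≡ b₂ × a₂ ℕ.< a₁)

Beyond : ℕ → ℕ × ℕ → ℕ × ℕ → ℕ → Set
Beyond k (b₁ , a₁) (b₂ , a₂) t = ∀ n → t ℕ.≤ n → k ℕ.* nab n a₂ b₂ ℕ.< nab n a₁ b₁

IsMonThreshold : ℕ → ℕ × ℕ → ℕ × ℕ → ℕ → Set
IsMonThreshold k p q t = Beyond k p q t × (∀ t' → Beyond k p q t' → t ℕ.≤ t')

ThresholdFn : (ℕ → ℕ × ℕ → ℕ × ℕ → ℕ) → Set
ThresholdFn th = ∀ k p q → p >lex q → (∃[ t ] IsMonThreshold k p q t) → IsMonThreshold k p q (th k p q)

-- membership of a term of Λ in Δ (with i,j), in Γ (with i,j), or neither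
data Tag : Set where
  inΔ  : ℕ → ℕ → Tag
  inΓ  : ℕ → ℕ → Tag
  rest : Tag

NotRest : Tag → Set
NotRest rest = ⊥
NotRest _ = ⊤

TagOK : ∀ {d} → Form (Fin d) → ℤ × Key d → Tag → Set
TagOK ψ' (c , e , a , b) (inΔ i j) =
  (∀ x → holds x ψ' → + 0 ℤ.< c ℤ.* monoZ x e) × ((j , i) >lex (b , a))
TagOK ψ' (c , e , a , b) (inΓ i j) =
  (∀ x → holds x ψ' → c ℤ.* monoZ x e ℤ.≤ + 0) × ((b , a) >lex (j , i))
TagOK ψ' _ rest = ⊤

-- npe‾ : replace n^a b^n by n^i j^n on Δ ∪ Γ
overTerm : ∀ {d} → ℤ × Key d → Tag → ℤ × Key d
overTerm (c , e , a , b) (inΔ i j) = (c , e , i , j)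
overTerm (c , e , a , b) (inΓ i j) = (c , e , i , j)
overTerm t rest = t

dTerm : (ℕ → ℕ × ℕ → ℕ × ℕ → ℕ) → ∀ {d} → ℤ × Key d → Tag → ℕ
dTerm th (c , e , a , b) (inΔ i j) = th 1 (j , i) (b , a)
dTerm th (c , e , a , b) (inΓ i j) = th 1 (b , a) (j , i)
dTerm th _ rest = 0

-- grouped form of npe‾ : entries (p_j , a_j , b_j), j = 1 … ℓ
GTerm : ℕ → Set
GTerm d = ZPoly d × ℕ × ℕ

gkey : ∀ {d} → GTerm d → ℕ × ℕ
gkey (p , a , b) = (b , a)

gTerm : ∀ {d} → (Fin d → ℤ) → ℕ → GTerm d → ℤ
gTerm x n (p , a , b) = evalZP x p ℤ.* (+ nab n a b)

-- 1-based access (default (0,0), never used)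
keyAt : List (ℕ × ℕ) → ℕ → ℕ × ℕ
keyAt [] _ = (0 , 0)
keyAt (k ∷ ks) zero = (0 , 0)
keyAt (k ∷ ks) (suc zero) = k
keyAt (k ∷ ks) (suc (suc j)) = keyAt ks (suc j)

Cα : (ℕ → ℕ × ℕ → ℕ × ℕ → ℕ) → List (ℕ × ℕ) → ℕ
Cα th ks = maxL 1 (map (λ j → Nj j ⊔ Mj j) (map (2 ℕ.+_) (upTo (length ks ∸ 1))))
  where
    kk : ℕ → ℕ × ℕ
    kk = keyAt ks
    Mj : ℕ → ℕ
    Mj j = if proj₁ (kk j) ℕ.≡ᵇ proj₁ (kk (j ∸ 1)) then 0
           else th 1 (kk j) (proj₁ (kk (j ∸ 1)) , suc (proj₂ (kk (j ∸ 1))))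
    Nj : ℕ → ℕ
    Nj 2 = 1
    Nj j = maxL 0 (map (λ i → th 1 (kk (j ∸ 2)) (kk i)) (map suc (upTo (j ∸ 3))))
           ⊔ th (j ∸ 2) (kk (j ∸ 1)) (kk (j ∸ 2))

coef : ∀ {d} → ZPoly d → Vec ℕ d → ℤ
coef q e = sumZ (map proj₁ (filter (λ m → VecP.≡-dec ℕ._≟_ (proj₂ m) e) q))

sqcup : ∀ {d} → List (ZPoly d) → Bound (Fin d)
sqcup qs = foldr _b+_ (bn 0)
  (map (λ e → bn (maxL 0 (map (λ q → ℤ.∣ coef q e ∣) qs)) b* monoB e)
       (deduplicate (VecP.≡-dec ℕ._≟_) (concatMap (map proj₂) qs)))

record AtomInfo (d : ℕ) : Set where
  field
    nf   : List (ℚ × Key d)     -- (s₂-s₁)[x/x̄] written as Σ q x^e n^a b^n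
    lam  : List (ℤ × Key d)
    tags : List Tag
    grp  : List (GTerm d)

lcmDen : ∀ {d} → List (ℚ × Key d) → ℕ
lcmDen nf = foldr lcm 1 (map (λ m → ↧ₙ (proj₁ m)) nf)

record AtomOK {d} (L : TLoop d) (cf : Fin d → List (CFTerm d))
              (α : Poly (Fin d) × Poly (Fin d)) (I : AtomInfo d) : Set where
  open AtomInfo I
  ψ' : Form (Fin d)
  ψ' = TLoop.pre L f∧ TLoop.guard L
  over : List (ℤ × Key d)
  over = zipWith overTerm lam tags
  field
    nf-unique  : Unique (map proj₂ nf)
    nf-nonzero : All (λ t → proj₁ t ≢ ℚ.0ℚ) nf
    nf-base    : All (λ t → 1 ℕ.≤ proj₂ (proj₂ (proj₂ t))) nf
    nf-eq      : ∀ x n → sumQ (map (termQ x n) nf) ≡ npeVal α cf x n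
    lam-eq     : Pointwise (λ c q → proj₂ c ≡ proj₂ q × toQ (proj₁ c) ≡ toQ (+ lcmDen nf) ℚ.* proj₁ q) lam nf
    tags-ok    : Pointwise (TagOK ψ') lam tags
    eventually : Any NotRest tags → ∀ x → holds x ψ' →
                 ∃[ N ] (∀ n → N ℕ.≤ n → sumZ (map (termZ x n) over) ℤ.≤ + 0)
    grp-sorted : Linked (λ g h → gkey h >lex gkey g) grp
    grp-nonzero : All (λ g → ∃[ x ] (evalZP x (proj₁ g) ≢ + 0)) grp
    grp-eq     : ∀ x n → sumZ (map (gTerm x n) grp) ≡ sumZ (map (termZ x n) over)

record IsStabBoundPoly {d} (L : TLoop d) (sth : Bound (Fin d)) : Set where
  field
    cf     : Fin d → List (CFTerm d)
    n₀     : ℕ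
    cf-ok  : IsClosedForm (TLoop.upd L) cf n₀
    th     : ℕ → ℕ × ℕ → ℕ × ℕ → ℕ
    th-ok  : ThresholdFn th
    infos  : List (AtomInfo d)
    infos-ok : Pointwise (AtomOK L cf) (atoms (TLoop.guard L)) infos
  Cmax : ℕ
  Cmax = maxL 0 (map (λ I → Cα th (map gkey (AtomInfo.grp I))) infos)
  Dmax : ℕ
  Dmax = maxL 0 (map (λ I → maxL 0 (zipWith (dTerm th) (AtomInfo.lam I) (AtomInfo.tags I))) infos)
  Pol : List (ZPoly d)
  Pol = concatMap (λ I → take (length (AtomInfo.grp I) ∸ 1) (map proj₁ (AtomInfo.grp I))) infos
  field
    sth-eq : sth ≡ (bn 2 b* sqcup Pol) b+ bn (n₀ ⊔ (Cmax ⊔ Dmax))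

module _ (P : Program) (C : SimpleCycle P) where
  open SimpleCycle C

  renV : Permutation′ (m P) → Var (m P) → Var (m P)
  renV π (inj₁ v) = inj₁ (π ⟨$⟩ʳ v)
  renV π (inj₂ u) = inj₂ u

  -- π(t) = (ℓ_i, φ_π, η_π, ℓ_i) is a twn-shaped transition over PV' = ι(Fin d)
  record TwnShape (i : Fin (suc n)) (π : Permutation′ (m P)) : Set where
    φπ : Form (Var (m P))
    φπ = mapF (renV π) (guard (cycleFrom i))
    ηπ : Fin (m P) → Poly (Var (m P))
    ηπ w = mapP (renV π) (upd (cycleFrom i) (π ⟨$⟩ˡ w))
    field
      d     : ℕ
      ι     : Fin d → Fin (m P)
      ι-inj : Injective _≡_ _≡_ ι
      φL    : Form (Fin d)
      φ-in  : FormEq φπ (mapF (inj₁ ∘ ι) φL)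
      c     : Fin d → ℤ
      p     : Fin d → Poly (Fin d)
      p-vars : ∀ k (x y : Fin d → ℤ) → (∀ j → toℕ k ℕ.< toℕ j → x j ≡ y j) → evalP x (p k) ≡ evalP y (p k)
      η-tri : ∀ k σ → evalP σ (ηπ (ι k)) ≡ c k ℤ.* σ (inj₁ (ι k)) ℤ.+ evalP (σ ∘ inj₁ ∘ ι) (p k)
      η-id  : ∀ v → (∀ k → ι k ≢ v) → ∀ σ → evalP σ (ηπ v) ≡ σ (inj₁ v)
    ηL : Fin d → Poly (Fin d)
    ηL k = (pc (c k) p* pv k) p+ p k

  record Choice (r : Trans (m P) (nL P)) (e : InE P C r) : Set where
    field
      π     : Permutation′ (m P)
      shape : TwnShape (InE.i e) π
    open TwnShape shape public
    field
      ψ        : Form (Fin d)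
      ψ-inv    : ∀ x → holds x ψ → holds x (substF ηL ψ)
      ψ-reach  : ∀ σ₀ σ → ReachVia P r σ₀ (ℓ (InE.i e)) σ →
                 holds (λ k → σ (inj₁ (π ⟨$⟩ˡ ι k))) ψ
    L : TLoop d
    L = tloop ψ φL ηL
    IsTnn : Set
    IsTnn = ∀ k → + 0 ℤ.≤ c k
    back : Bound (Fin d) → Bound (Fin (m P))
    back = mapB (λ k → π ⟨$⟩ˡ ι k)

  -- 𝓡𝓑_loc(r) = b  is a possible output of the algorithm
  data AlgOutput (r : Trans (m P) (nL P)) (e : InE P C r) : Bound (Fin (m P)) → Set where
    no-shape : ¬ (Σ (Permutation′ (m P)) (TwnShape (InE.i e))) → AlgOutput r e bω
    tnn-case : (ch : Choice r e) → Choice.IsTnn ch → Terminating (loopProgram (Choice.L ch)) →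
               (sth : Bound (Fin (Choice.d ch))) → IsStabBoundPoly (Choice.L ch) sth →
               AlgOutput r e (Choice.back ch (bn 1 b+ sth))
    twn-case : (ch : Choice r e) → ¬ Choice.IsTnn ch → Terminating (loopProgram (Choice.L ch)) →
               (sth : Bound (Fin (Choice.d ch))) → IsStabBoundPoly (Choice.L ch ⋆L Choice.L ch) sth →
               AlgOutput r e (Choice.back ch (bn 1 b+ ((bn 2 b* sth) b+ bn 1)))
    nonterm-case : (ch : Choice r e) → ¬ Terminating (loopProgram (Choice.L ch)) → AlgOutput r e bω

-- From the location ℓ_i where r enters the cycle, each full round through the
-- cycle fires the chained transition t, which after the renaming π is one
-- iteration of the loop L; so k uses of a cycle transition after r yield a run
-- of L of length k − 1 from a state satisfying ψ.  Such runs are bounded by the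
-- stabilization bound polynomial sth: for n ≥ sth(|x|) the term of npe‾_α with
-- the largest (b, a) dominates all others, so the sign of every atom of the
-- guard is fixed from then on, and a guard still true at iteration sth would
-- stay true forever, contradicting termination.  For a twn-loop that is not
-- tnn the argument is applied to L ⋆ L, which runs ⌊K/2⌋ iterations when L
-- runs K.

module Submission where

open import Defs
open import Data.Nat as ℕ using (ℕ; zero; suc; _+_; _*_; _^_; _∸_; _≤_; _<_; _⊔_; _<?_; _≤?_; z≤n; s≤s; NonZero)
open import Data.Nat.Properties
open import Data.Nat.Combinatorics using (nC1≡n; nCk+nC[k+1]≡[n+1]C[k+1]) renaming (_C_ to _choose_)
open import Data.Nat.DivMod using (_%_; m<n⇒m%n≡m; [m+n]%n≡m%n; %-distribˡ-+; m%n%n≡m%n)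
open import Data.Nat.GCD using (gcd; gcd-zeroʳ)
open import Data.Nat.LCM using (lcm; gcd*lcm)
open import Data.Nat.Tactic.RingSolver using () renaming (solve-∀ to solveℕ)
open import Data.Integer as ℤ using (ℤ; +_; -[1+_]; ∣_∣)
import Data.Integer.Properties as ℤP
open import Data.Integer.Tactic.RingSolver using () renaming (solve-∀ to solveℤ)
open import Data.Rational as ℚ using (ℚ; ↥_; ↧_)
import Data.Rational.Properties as ℚP
import Data.Rational.Unnormalised as ℚᵘ
import Data.Rational.Unnormalised.Properties as ℚᵘP
open import Data.Fin as Fin using (Fin; toℕ)
import Data.Fin.Properties as FinP
open import Data.Fin.Permutation using (_⟨$⟩ˡ_; inverseˡ)
open import Data.Vec using (Vec; []; _∷_)
import Data.Vec.Properties as VecP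
open import Data.List using (List; []; _∷_; map; foldr; concatMap; applyUpTo; upTo; length; take; zipWith; deduplicate)
open import Data.List.Properties using (map-applyUpTo; length-map; take-map)
open import Data.List.Membership.Propositional using (_∈_; lose)
open import Data.List.Membership.Propositional.Properties using (∈-map⁺; ∈-upTo⁺; ∈-concatMap⁺; ∈-deduplicate⁺)
open import Data.List.Relation.Unary.Any using (Any; here; there)
open import Data.List.Relation.Unary.All as All using (All; []; _∷_)
import Data.List.Relation.Unary.All.Properties as AllP
open import Data.List.Relation.Unary.AllPairs using ([]; _∷_)
open import Data.List.Relation.Unary.Unique.Propositional using (Unique)
import Data.List.Relation.Unary.Unique.DecPropositional.Properties as UniqueP
open import Data.List.Relation.Unary.Linked as Linked using (Linked; _∷_)
open import Data.List.Relation.Binary.Pointwise using (Pointwise; []; _∷_)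
open import Data.Maybe using (just; nothing)
open import Data.Product using (Σ; ∃-syntax; _×_; _,_; proj₁; proj₂)
open import Data.Sum using (_⊎_; inj₁; inj₂)
open import Data.Empty using (⊥-elim)
open import Data.Unit using (tt)
open import Data.Bool as Bool using (true; false; if_then_else_)
open import Function using (_∘_; id; case_of_)
open import Relation.Nullary using (¬_; Dec; yes; no)
open import Relation.Binary.PropositionalEquality renaming (trans to ≡-trans)
open import Relation.Binary.Construct.Closure.ReflexiveTransitive using (Star; ε; _◅_)

-- Growth of n^a b^n

pascal : ∀ n k → (suc n choose suc k) ≡ (n choose k) + (n choose suc k)
pascal n k = sym (nCk+nC[k+1]≡[n+1]C[k+1] n k)

[1+k]*[1+n]C[1+k]≡[1+n]*nCk : ∀ n k → suc k * (suc n choose suc k) ≡ suc n * (n choose k)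
[1+k]*[1+n]C[1+k]≡[1+n]*nCk zero zero = refl
[1+k]*[1+n]C[1+k]≡[1+n]*nCk zero (suc k) = *-zeroʳ (suc (suc k))
[1+k]*[1+n]C[1+k]≡[1+n]*nCk (suc n) zero =
  ≡-trans (*-identityˡ _) (≡-trans (nC1≡n (suc (suc n))) (sym (*-identityʳ _)))
[1+k]*[1+n]C[1+k]≡[1+n]*nCk (suc n) (suc k) = begin
  suc (suc k) * (suc (suc n) choose suc (suc k))
    ≡⟨ cong (suc (suc k) *_) (pascal (suc n) (suc k)) ⟩
  suc (suc k) * (A + B)
    ≡⟨ split-factor k A B ⟩
  A + suc k * A + suc (suc k) * B
    ≡⟨ cong₂ (λ u v → A + u + v) ([1+k]*[1+n]C[1+k]≡[1+n]*nCk n k) ([1+k]*[1+n]C[1+k]≡[1+n]*nCk n (suc k)) ⟩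
  A + suc n * (n choose k) + suc n * (n choose suc k)
    ≡⟨ cong (λ u → u + suc n * (n choose k) + suc n * (n choose suc k)) (pascal n k) ⟩
  ((n choose k) + (n choose suc k)) + suc n * (n choose k) + suc n * (n choose suc k)
    ≡⟨ merge-factor n (n choose k) (n choose suc k) ⟩
  suc (suc n) * ((n choose k) + (n choose suc k))
    ≡⟨ cong (suc (suc n) *_) (sym (pascal n k)) ⟩
  suc (suc n) * (suc n choose suc k)
  ∎
  where
  open ≡-Reasoning
  A = suc n choose suc k
  B = suc n choose suc (suc k)
  split-factor : ∀ k a b → suc (suc k) * (a + b) ≡ a + suc k * a + suc (suc k) * b
  split-factor = solveℕ
  merge-factor : ∀ n a b → (a + b) + suc n * a + suc n * b ≡ suc (suc n) * (a + b)
  merge-factor = solveℕ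

-- The binomial theorem, keeping only the term b^(n-k) of (b + 1)^n.
nCk*b^n≤b^k*[1+b]^n : ∀ b n k → (n choose k) * b ^ n ≤ b ^ k * suc b ^ n
nCk*b^n≤b^k*[1+b]^n b n zero = begin
  (n choose 0) * b ^ n  ≡⟨ *-identityˡ (b ^ n) ⟩
  b ^ n                 ≤⟨ ^-monoˡ-≤ n (n≤1+n b) ⟩
  suc b ^ n             ≡⟨ sym (*-identityˡ (suc b ^ n)) ⟩
  1 * suc b ^ n         ∎
  where open ≤-Reasoning
nCk*b^n≤b^k*[1+b]^n b zero (suc k) = z≤n
nCk*b^n≤b^k*[1+b]^n b (suc n) (suc k) = begin
  (suc n choose suc k) * (b * b ^ n)
    ≡⟨ cong (_* (b * b ^ n)) (pascal n k) ⟩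
  ((n choose k) + (n choose suc k)) * (b * b ^ n)
    ≡⟨ distribute (n choose k) (n choose suc k) b (b ^ n) ⟩
  b * ((n choose k) * b ^ n) + b * ((n choose suc k) * b ^ n)
    ≤⟨ +-mono-≤ (*-monoʳ-≤ b (nCk*b^n≤b^k*[1+b]^n b n k)) (*-monoʳ-≤ b (nCk*b^n≤b^k*[1+b]^n b n (suc k))) ⟩
  b * (b ^ k * suc b ^ n) + b * ((b * b ^ k) * suc b ^ n)
    ≡⟨ collect b (b ^ k) (suc b ^ n) ⟩
  (b * b ^ k) * (suc b * suc b ^ n)
  ∎
  where
  open ≤-Reasoning
  distribute : ∀ x y b z → (x + y) * (b * z) ≡ b * (x * z) + b * (y * z)
  distribute = solveℕ
  collect : ∀ b x y → b * (x * y) + b * ((b * x) * y) ≡ (b * x) * (suc b * y)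
  collect = solveℕ

[1+m]^a≤2^a*m^a : ∀ m a → 1 ≤ m → suc m ^ a ≤ 2 ^ a * m ^ a
[1+m]^a≤2^a*m^a m zero _ = ≤-refl
[1+m]^a≤2^a*m^a m (suc a) 1≤m = begin
  suc m * suc m ^ a              ≤⟨ *-mono-≤ (+-monoˡ-≤ m 1≤m) ([1+m]^a≤2^a*m^a m a 1≤m) ⟩
  (m + m) * (2 ^ a * m ^ a)      ≡⟨ reassociate m (2 ^ a) (m ^ a) ⟩
  (2 * 2 ^ a) * (m * m ^ a)      ∎
  where
  open ≤-Reasoning
  reassociate : ∀ m x y → (m + m) * (x * y) ≡ (2 * x) * (m * y)
  reassociate = solveℕ

-- Induction on a via the absorption identity: C(n+1, a+2) = (n+1)/(a+2) · C(n, a+1).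
poly<binomial : ∀ a K → ∃[ N ] (∀ n → N ≤ n → K * n ^ a < (n choose suc a))
poly<binomial zero K = suc K , λ n le → subst₂ _<_ (sym (*-identityʳ K)) (sym (nC1≡n n)) le
poly<binomial (suc a) K with poly<binomial a (suc (suc a) * K * 2 ^ a)
... | N , bound = suc (N ⊔ 1) , λ { (suc m) (s≤s le) → step m (≤-trans (m≤m⊔n N 1) le) (≤-trans (m≤n⊔m N 1) le) }
  where
  step : ∀ m → N ≤ m → 1 ≤ m → K * suc m ^ suc a < (suc m choose suc (suc a))
  step m N≤m 1≤m = *-cancelˡ-< (suc (suc a)) _ _ (begin-strict
      suc (suc a) * (K * suc m ^ suc a)
    ≡⟨ reassociate a K m (suc m ^ a) ⟩
      suc m * (suc (suc a) * K * suc m ^ a)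
    ≤⟨ *-monoʳ-≤ (suc m) (*-monoʳ-≤ (suc (suc a) * K) ([1+m]^a≤2^a*m^a m a 1≤m)) ⟩
      suc m * (suc (suc a) * K * (2 ^ a * m ^ a))
    ≡⟨ cong (suc m *_) (sym (*-assoc (suc (suc a) * K) (2 ^ a) (m ^ a))) ⟩
      suc m * (suc (suc a) * K * 2 ^ a * m ^ a)
    <⟨ *-monoʳ-< (suc m) (bound m N≤m) ⟩
      suc m * (m choose suc a)
    ≡⟨ sym ([1+k]*[1+n]C[1+k]≡[1+n]*nCk m (suc a)) ⟩
      suc (suc a) * (suc m choose suc (suc a))
    ∎)
    where
    open ≤-Reasoning
    reassociate : ∀ a K m x → suc (suc a) * (K * (suc m * x)) ≡ suc m * (suc (suc a) * K * x)
    reassociate = solveℕ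

poly*exp<exp : ∀ a b k → ∃[ N ] (∀ n → N ≤ n → k * nab n a (suc b) < suc (suc b) ^ n)
poly*exp<exp a b k with poly<binomial a (k * suc b ^ suc a)
... | N , bound = N , λ n N≤n → *-cancelˡ-< (suc b ^ suc a) _ _ (begin-strict
      suc b ^ suc a * (k * (n ^ a * suc b ^ n))
    ≡⟨ reassociate (suc b ^ suc a) k (n ^ a) (suc b ^ n) ⟩
      k * suc b ^ suc a * n ^ a * suc b ^ n
    <⟨ *-monoˡ-< (suc b ^ n) {{m^n≢0 (suc b) n}} (bound n N≤n) ⟩
      (n choose suc a) * suc b ^ n
    ≤⟨ nCk*b^n≤b^k*[1+b]^n (suc b) n (suc a) ⟩
      suc b ^ suc a * suc (suc b) ^ n
    ∎)
  where
  open ≤-Reasoning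
  instance _ = m^n≢0 (suc b) (suc a)
  reassociate : ∀ x k y z → x * (k * (y * z)) ≡ k * x * y * z
  reassociate = solveℕ

nab-pos : ∀ n a b → 1 ≤ n → 1 ≤ b → 1 ≤ nab n a b
nab-pos n a b 1≤n 1≤b = *-mono-≤ (m^n>0 n a) (m^n>0 b n)
  where instance
    _ = ℕ.>-nonZero 1≤n
    _ = ℕ.>-nonZero 1≤b

nab-zeroʳ : ∀ n a → 1 ≤ n → nab n a 0 ≡ 0
nab-zeroʳ (suc n) a _ = *-zeroʳ (suc n ^ a)

>lex⇒beyond : ∀ k b₁ a₁ b₂ a₂ → 1 ≤ b₁ → (b₁ , a₁) >lex (b₂ , a₂) → ∃[ t ] Beyond k (b₁ , a₁) (b₂ , a₂) t
>lex⇒beyond k b₁ a₁ zero a₂ 1≤b₁ (inj₁ _) = 1 , λ n 1≤n →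
  subst (_< nab n a₁ b₁) (sym (≡-trans (cong (k *_) (nab-zeroʳ n a₂ 1≤n)) (*-zeroʳ k))) (nab-pos n a₁ b₁ 1≤n 1≤b₁)
>lex⇒beyond k b₁ a₁ (suc b) a₂ _ (inj₁ b+1<b₁) with poly*exp<exp a₂ b k
... | N , bound = N ⊔ 1 , beats
  where
  beats : Beyond k (b₁ , a₁) (suc b , a₂) (N ⊔ 1)
  beats n le = begin-strict
      k * nab n a₂ (suc b)  <⟨ bound n (≤-trans (m≤m⊔n N 1) le) ⟩
      suc (suc b) ^ n       ≤⟨ ^-monoˡ-≤ n b+1<b₁ ⟩
      b₁ ^ n                ≡⟨ sym (*-identityˡ _) ⟩
      1 * b₁ ^ n            ≤⟨ *-monoˡ-≤ (b₁ ^ n) (m^n>0 n a₁) ⟩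
      n ^ a₁ * b₁ ^ n       ∎
    where
    open ≤-Reasoning
    instance _ = ℕ.>-nonZero (≤-trans (m≤n⊔m N 1) le)
>lex⇒beyond k b₁ a₁ b₂ a₂ 1≤b₁ (inj₂ (refl , a₂<a₁)) = suc k , beats
  where
  beats : Beyond k (b₁ , a₁) (b₁ , a₂) (suc k)
  beats n k<n = begin-strict
      k * (n ^ a₂ * b₁ ^ n)   <⟨ *-monoˡ-< (n ^ a₂ * b₁ ^ n) k<n ⟩
      n * (n ^ a₂ * b₁ ^ n)   ≡⟨ sym (*-assoc n (n ^ a₂) (b₁ ^ n)) ⟩
      n ^ suc a₂ * b₁ ^ n     ≤⟨ *-monoˡ-≤ (b₁ ^ n) (^-monoʳ-≤ n a₂<a₁) ⟩
      n ^ a₁ * b₁ ^ n         ∎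
    where
    open ≤-Reasoning
    instance
      _ = ℕ.>-nonZero (≤-trans (s≤s z≤n) k<n)
      _ = ℕ.>-nonZero (nab-pos n a₂ b₁ (≤-trans (s≤s z≤n) k<n) 1≤b₁)

beyond⇒threshold : ∀ k p q t₀ → Beyond k p q t₀ → ∃[ t ] IsMonThreshold k p q t
beyond⇒threshold k p q zero beyond = zero , beyond , λ _ _ → z≤n
beyond⇒threshold k p@(b₁ , a₁) q@(b₂ , a₂) (suc t) beyond with k * nab t a₂ b₂ <? nab t a₁ b₁
... | no fails-at-t = suc t , beyond , λ t' beyond' → ≰⇒> λ t'≤t → fails-at-t (beyond' t t'≤t)
... | yes holds-at-t = beyond⇒threshold k p q t λ n t≤n → case m≤n⇒m<n∨m≡n t≤n of λ where
  (inj₁ t<n) → beyond n t<n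
  (inj₂ refl) → holds-at-t

threshold-beyond : ∀ {th} → ThresholdFn th → ∀ k b₁ a₁ b₂ a₂ → 1 ≤ b₁ → (b₁ , a₁) >lex (b₂ , a₂) →
                   Beyond k (b₁ , a₁) (b₂ , a₂) (th k (b₁ , a₁) (b₂ , a₂))
threshold-beyond th-ok k b₁ a₁ b₂ a₂ 1≤b₁ p>q =
  let t₀ , beyond = >lex⇒beyond k b₁ a₁ b₂ a₂ 1≤b₁ p>q
  in proj₁ (th-ok k _ _ p>q (beyond⇒threshold k (b₁ , a₁) (b₂ , a₂) t₀ beyond))

-- Evaluation of polynomials, formulas and transitions

coerce : ∀ {A B : Set} → A ≡ B → A → B
coerce = subst (λ X → X)

module _ {V : Set} where

  evalP-cong : ∀ {σ τ : V → ℤ} → (∀ v → σ v ≡ τ v) → ∀ p → evalP σ p ≡ evalP τ p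
  evalP-cong σ≗τ (pc c) = refl
  evalP-cong σ≗τ (pv v) = σ≗τ v
  evalP-cong σ≗τ (p p+ q) = cong₂ ℤ._+_ (evalP-cong σ≗τ p) (evalP-cong σ≗τ q)
  evalP-cong σ≗τ (p p* q) = cong₂ ℤ._*_ (evalP-cong σ≗τ p) (evalP-cong σ≗τ q)

  holds-cong : ∀ {σ τ : V → ℤ} → (∀ v → σ v ≡ τ v) → ∀ φ → holds σ φ ≡ holds τ φ
  holds-cong σ≗τ (p f< q) = cong₂ ℤ._<_ (evalP-cong σ≗τ p) (evalP-cong σ≗τ q)
  holds-cong σ≗τ (φ f∧ ψ) = cong₂ _×_ (holds-cong σ≗τ φ) (holds-cong σ≗τ ψ)
  holds-cong σ≗τ (φ f∨ ψ) = cong₂ _⊎_ (holds-cong σ≗τ φ) (holds-cong σ≗τ ψ)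

  holds-FormEq : ∀ (σ : V → ℤ) φ φ' → FormEq φ φ' → holds σ φ → holds σ φ'
  holds-FormEq σ (p f< q) (p' f< q') (p≈p' , q≈q') h = subst₂ ℤ._<_ (p≈p' σ) (q≈q' σ) h
  holds-FormEq σ (φ f∧ ψ) (φ' f∧ ψ') (φ≈ , ψ≈) (hφ , hψ) = holds-FormEq σ φ φ' φ≈ hφ , holds-FormEq σ ψ ψ' ψ≈ hψ
  holds-FormEq σ (φ f∨ ψ) (φ' f∨ ψ') (φ≈ , ψ≈) (inj₁ h) = inj₁ (holds-FormEq σ φ φ' φ≈ h)
  holds-FormEq σ (φ f∨ ψ) (φ' f∨ ψ') (φ≈ , ψ≈) (inj₂ h) = inj₂ (holds-FormEq σ ψ ψ' ψ≈ h)

module _ {V W : Set} where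

  evalP-mapP : ∀ (f : V → W) (σ : W → ℤ) p → evalP σ (mapP f p) ≡ evalP (σ ∘ f) p
  evalP-mapP f σ (pc c) = refl
  evalP-mapP f σ (pv v) = refl
  evalP-mapP f σ (p p+ q) = cong₂ ℤ._+_ (evalP-mapP f σ p) (evalP-mapP f σ q)
  evalP-mapP f σ (p p* q) = cong₂ ℤ._*_ (evalP-mapP f σ p) (evalP-mapP f σ q)

  holds-mapF : ∀ (f : V → W) (σ : W → ℤ) φ → holds σ (mapF f φ) ≡ holds (σ ∘ f) φ
  holds-mapF f σ (p f< q) = cong₂ ℤ._<_ (evalP-mapP f σ p) (evalP-mapP f σ q)
  holds-mapF f σ (φ f∧ ψ) = cong₂ _×_ (holds-mapF f σ φ) (holds-mapF f σ ψ)
  holds-mapF f σ (φ f∨ ψ) = cong₂ _⊎_ (holds-mapF f σ φ) (holds-mapF f σ ψ)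

  evalP-substP : ∀ (f : V → Poly W) (σ : W → ℤ) p → evalP σ (substP f p) ≡ evalP (λ v → evalP σ (f v)) p
  evalP-substP f σ (pc c) = refl
  evalP-substP f σ (pv v) = refl
  evalP-substP f σ (p p+ q) = cong₂ ℤ._+_ (evalP-substP f σ p) (evalP-substP f σ q)
  evalP-substP f σ (p p* q) = cong₂ ℤ._*_ (evalP-substP f σ p) (evalP-substP f σ q)

  holds-substF : ∀ (f : V → Poly W) (σ : W → ℤ) φ → holds σ (substF f φ) ≡ holds (λ v → evalP σ (f v)) φ
  holds-substF f σ (p f< q) = cong₂ ℤ._<_ (evalP-substP f σ p) (evalP-substP f σ q)
  holds-substF f σ (φ f∧ ψ) = cong₂ _×_ (holds-substF f σ φ) (holds-substF f σ ψ)
  holds-substF f σ (φ f∨ ψ) = cong₂ _⊎_ (holds-substF f σ φ) (holds-substF f σ ψ)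

module _ {m : ℕ} where

  _≈PV_ : State m → State m → Set
  σ ≈PV σ' = ∀ v → σ (inj₁ v) ≡ σ' (inj₁ v)

  holds-≈PV : ∀ (φ : Form (Var m)) → All (λ a → NoTempP (proj₁ a) × NoTempP (proj₂ a)) (atoms φ) →
              ∀ {σ σ'} → σ ≈PV σ' → holds σ φ → holds σ' φ
  holds-≈PV (p f< q) ((p-free , q-free) ∷ []) σ≈σ' h = subst₂ ℤ._<_ (p-free _ _ σ≈σ') (q-free _ _ σ≈σ') h
  holds-≈PV (φ f∧ ψ) free σ≈σ' (hφ , hψ) =
    holds-≈PV φ (AllP.++⁻ˡ (atoms φ) free) σ≈σ' hφ , holds-≈PV ψ (AllP.++⁻ʳ (atoms φ) free) σ≈σ' hψ
  holds-≈PV (φ f∨ ψ) free σ≈σ' (inj₁ h) = inj₁ (holds-≈PV φ (AllP.++⁻ˡ (atoms φ) free) σ≈σ' h)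
  holds-≈PV (φ f∨ ψ) free σ≈σ' (inj₂ h) = inj₂ (holds-≈PV ψ (AllP.++⁻ʳ (atoms φ) free) σ≈σ' h)

  -- The semantic counterpart of NoTempT, which, unlike it, is preserved by chaining.
  PVDetermined : ∀ {nL} → Trans m nL → Set
  PVDetermined t = (∀ {σ σ'} → σ ≈PV σ' → holds σ (guard t) → holds σ' (guard t)) ×
                   (∀ v {σ σ'} → σ ≈PV σ' → evalP σ (upd t v) ≡ evalP σ' (upd t v))

  noTemp⇒pvDetermined : ∀ {nL} (t : Trans m nL) → NoTempT t → PVDetermined t
  noTemp⇒pvDetermined t (guard-free , upd-free) = holds-≈PV (guard t) guard-free , λ v → upd-free v _ _

  Fires : ∀ {nL} → Trans m nL → State m → State m → Set
  Fires s σ σ' = holds σ (guard s) × (∀ v → σ' (inj₁ v) ≡ evalP σ (upd s v))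

  stepVia⇒fires : ∀ {nL} (s : Trans m nL) {c c'} → StepVia s c c' → Fires s (proj₂ c) (proj₂ c')
  stepVia⇒fires s (_ , _ , g , u) = g , u

  after : ∀ {nL} → Trans m nL → State m → State m
  after s σ v = evalP σ (updSubst (upd s) v)

  fires-⋆ : ∀ {nL} (s₁ s₂ : Trans m nL) → PVDetermined s₂ →
            ∀ {σ σ₁ σ₂} → Fires s₁ σ σ₁ → Fires s₂ σ₁ σ₂ → Fires (s₁ ⋆ s₂) σ σ₂
  fires-⋆ s₁ s₂ (guard-det , upd-det) {σ} {σ₁} {σ₂} (g₁ , u₁) (g₂ , u₂) =
      (g₁ , coerce (sym (holds-substF (updSubst (upd s₁)) σ (guard s₂))) (guard-det u₁ g₂))
    , λ v → ≡-trans (u₂ v) (≡-trans (upd-det v u₁) (sym (evalP-substP (updSubst (upd s₁)) σ (upd s₂ v))))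

  pvDetermined-⋆ : ∀ {nL} (s₁ s₂ : Trans m nL) → PVDetermined s₁ → PVDetermined s₂ → PVDetermined (s₁ ⋆ s₂)
  pvDetermined-⋆ s₁ s₂ (guard-det₁ , upd-det₁) (guard-det₂ , upd-det₂) = guard-det , upd-det
    where
    after-≈PV : ∀ {σ σ'} → σ ≈PV σ' → after s₁ σ ≈PV after s₁ σ'
    after-≈PV σ≈σ' v = upd-det₁ v σ≈σ'
    guard-det : ∀ {σ σ'} → σ ≈PV σ' → holds σ (guard (s₁ ⋆ s₂)) → holds σ' (guard (s₁ ⋆ s₂))
    guard-det {σ} {σ'} σ≈σ' (h₁ , h₂) =
        guard-det₁ σ≈σ' h₁
      , coerce (sym (holds-substF (updSubst (upd s₁)) σ' (guard s₂)))
          (guard-det₂ (after-≈PV σ≈σ') (coerce (holds-substF (updSubst (upd s₁)) σ (guard s₂)) h₂))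
    upd-det : ∀ v {σ σ'} → σ ≈PV σ' → evalP σ (upd (s₁ ⋆ s₂) v) ≡ evalP σ' (upd (s₁ ⋆ s₂) v)
    upd-det v {σ} {σ'} σ≈σ' = begin
      evalP σ (substP (updSubst (upd s₁)) (upd s₂ v))   ≡⟨ evalP-substP (updSubst (upd s₁)) σ (upd s₂ v) ⟩
      evalP (after s₁ σ) (upd s₂ v)                      ≡⟨ upd-det₂ v (after-≈PV σ≈σ') ⟩
      evalP (after s₁ σ') (upd s₂ v)                     ≡⟨ evalP-substP (updSubst (upd s₁)) σ' (upd s₂ v) ⟨
      evalP σ' (substP (updSubst (upd s₁)) (upd s₂ v))  ∎
      where open ≡-Reasoning

  Along : ∀ {nL} → List (Trans m nL) → Config m nL → Config m nL → Set
  Along [] c c' = c ≡ c'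
  Along (u ∷ us) c c' = ∃[ c₁ ] (StepVia u c c₁ × Along us c₁ c')

  pvDetermined-chain : ∀ {nL} (t : Trans m nL) us → PVDetermined t → All PVDetermined us → PVDetermined (chain t us)
  pvDetermined-chain t [] t-det [] = t-det
  pvDetermined-chain t (u ∷ us) t-det (u-det ∷ us-det) =
    pvDetermined-⋆ t (chain u us) t-det (pvDetermined-chain u us u-det us-det)

  along⇒fires-chain : ∀ {nL} (t : Trans m nL) us → All PVDetermined us →
                      ∀ {c c'} → Along (t ∷ us) c c' → Fires (chain t us) (proj₂ c) (proj₂ c')
  along⇒fires-chain t [] [] {c} (c₁ , step , refl) = stepVia⇒fires t {c} {c₁} step
  along⇒fires-chain t (u ∷ us) (u-det ∷ us-det) {c} {c'} (c₁ , step , run) =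
    fires-⋆ t (chain u us) (pvDetermined-chain u us u-det us-det) {proj₂ c} {proj₂ c₁} {proj₂ c'}
      (stepVia⇒fires t {c} {c₁} step) (along⇒fires-chain u us us-det {c₁} {c'} run)

-- Iterated updates and loops

module _ {d : ℕ} (η : Fin d → Poly (Fin d)) where

  iterUpd-suc : ∀ n x k → iterUpd η (suc n) x k ≡ iterUpd η n (λ j → evalP x (η j)) k
  iterUpd-suc zero x k = refl
  iterUpd-suc (suc n) x k = evalP-cong (λ j → iterUpd-suc n x j) (η k)

  iterUpd-cong : ∀ n {x y} → (∀ k → x k ≡ y k) → ∀ k → iterUpd η n x k ≡ iterUpd η n y k
  iterUpd-cong zero x≗y k = x≗y k
  iterUpd-cong (suc n) x≗y k = evalP-cong (iterUpd-cong n x≗y) (η k)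

  iterUpd-twice : ∀ n x k → iterUpd (λ j → substP η (η j)) n x k ≡ iterUpd η (n + n) x k
  iterUpd-twice zero x k = refl
  iterUpd-twice (suc n) x k = begin
    evalP (iterUpd (λ j → substP η (η j)) n x) (substP η (η k))
      ≡⟨ evalP-substP η _ (η k) ⟩
    evalP (λ j → evalP (iterUpd (λ j → substP η (η j)) n x) (η j)) (η k)
      ≡⟨ evalP-cong (λ j → evalP-cong (iterUpd-twice n x) (η j)) (η k) ⟩
    iterUpd η (suc (suc (n + n))) x k
      ≡⟨ cong (λ z → iterUpd η (suc z) x k) (+-suc n n) ⟨
    iterUpd η (suc n + suc n) x k
      ∎
    where open ≡-Reasoning

InfiniteRun : ∀ {d} → TLoop d → Set
InfiniteRun {d} L = Σ (Fin d → ℤ) λ x → holds x (TLoop.pre L) × (∀ n → holds (iterUpd (TLoop.upd L) n x) (TLoop.guard L))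

even-or-odd : ∀ n → ∃[ h ] (n ≡ h + h ⊎ n ≡ suc (h + h))
even-or-odd zero = 0 , inj₁ refl
even-or-odd (suc n) with even-or-odd n
... | h , inj₁ n≡2h = h , inj₂ (cong suc n≡2h)
... | h , inj₂ n≡2h+1 = suc h , inj₁ (≡-trans (cong suc n≡2h+1) (cong suc (sym (+-suc h h))))

infiniteRun-⋆L : ∀ {d} (L : TLoop d) → InfiniteRun (L ⋆L L) → InfiniteRun L
infiniteRun-⋆L L (x , x⊨ψ , guards) = x , x⊨ψ , every
  where
  open TLoop L using () renaming (pre to ψ; guard to φ; upd to η)
  every : ∀ n → holds (iterUpd η n x) φ
  every n with even-or-odd n
  ... | h , inj₁ refl = coerce (holds-cong (iterUpd-twice η h x) φ) (proj₁ (guards h))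
  ... | h , inj₂ refl = coerce (≡-trans (holds-substF η _ φ) (holds-cong (λ k → evalP-cong (iterUpd-twice η h x) (η k)) φ))
                          (proj₂ (guards h))

terminating⇒¬infiniteRun : ∀ {d} (L : TLoop d) → Terminating (loopProgram L) → ¬ InfiniteRun L
terminating⇒¬infiniteRun {d} L terminates (x , x⊨ψ , guards) = terminates (run , refl , steps)
  where
  open TLoop L using () renaming (pre to ψ; guard to φ; upd to η)
  -- Temporaries are irrelevant; they are set to 0.
  state : (Fin d → ℤ) → State d
  state y (inj₁ k) = y k
  state y (inj₂ _) = ℤ.+ 0
  run : ℕ → Config d 2
  run zero = Fin.zero , state x
  run (suc n) = Fin.suc Fin.zero , state (iterUpd η n x)
  steps : ∀ n → StepT (Program.T (loopProgram L)) (run n) (run (suc n))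
  steps zero = _ , here refl , refl , refl , coerce (sym (holds-mapF inj₁ (state x) ψ)) x⊨ψ , λ v → refl
  steps (suc n) = _ , there (here refl) , refl , refl ,
    coerce (sym (holds-mapF inj₁ (state (iterUpd η n x)) φ)) (guards n) ,
    λ v → sym (evalP-mapP inj₁ (state (iterUpd η n x)) (η v))

-- The cyclic successor

iter-suc : ∀ {A : Set} (f : A → A) s x → iter s f (f x) ≡ f (iter s f x)
iter-suc f zero x = refl
iter-suc f (suc s) x = cong f (iter-suc f s x)

toℕ-next : ∀ {n} (k : Fin (suc n)) → toℕ (next k) ≡ suc (toℕ k) % suc n
toℕ-next {n} k with suc (toℕ k) <? suc n
... | yes k+1<n+1 = ≡-trans (FinP.toℕ-fromℕ< k+1<n+1) (sym (m<n⇒m%n≡m k+1<n+1))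
... | no k+1≮n+1 = sym (≡-trans (cong (_% suc n) k+1≡n+1) ([m+n]%n≡m%n 0 (suc n)))
  where
  k+1≡n+1 : suc (toℕ k) ≡ suc n
  k+1≡n+1 = ≤-antisym (FinP.toℕ<n k) (≮⇒≥ k+1≮n+1)

toℕ-iter-next : ∀ {n} s (q : Fin (suc n)) → toℕ (iter s next q) ≡ (toℕ q + s) % suc n
toℕ-iter-next {n} zero q = sym (≡-trans (cong (_% suc n) (+-identityʳ (toℕ q))) (m<n⇒m%n≡m (FinP.toℕ<n q)))
toℕ-iter-next {n} (suc s) q = begin
    toℕ (next (iter s next q))
  ≡⟨ toℕ-next (iter s next q) ⟩
    (1 + toℕ (iter s next q)) % suc n
  ≡⟨ cong (λ z → (1 + z) % suc n) (toℕ-iter-next s q) ⟩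
    (1 + (toℕ q + s) % suc n) % suc n
  ≡⟨ %-distribˡ-+ 1 ((toℕ q + s) % suc n) (suc n) ⟩
    (1 % suc n + (toℕ q + s) % suc n % suc n) % suc n
  ≡⟨ cong (λ z → (1 % suc n + z) % suc n) (m%n%n≡m%n (toℕ q + s) (suc n)) ⟩
    (1 % suc n + (toℕ q + s) % suc n) % suc n
  ≡⟨ %-distribˡ-+ 1 (toℕ q + s) (suc n) ⟨
    (1 + (toℕ q + s)) % suc n
  ≡⟨ cong (_% suc n) (+-suc (toℕ q) s) ⟨
    (toℕ q + suc s) % suc n
  ∎
  where open ≡-Reasoning

iter-next-period : ∀ {n} (q : Fin (suc n)) → iter (suc n) next q ≡ q
iter-next-period {n} q = FinP.toℕ-injective (begin
  toℕ (iter (suc n) next q)   ≡⟨ toℕ-iter-next (suc n) q ⟩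
  (toℕ q + suc n) % suc n     ≡⟨ [m+n]%n≡m%n (toℕ q) (suc n) ⟩
  toℕ q % suc n               ≡⟨ m<n⇒m%n≡m (FinP.toℕ<n q) ⟩
  toℕ q                       ∎)
  where open ≡-Reasoning

[j+k]%d≢j : ∀ {j k d} .{{_ : NonZero d}} → j < d → 0 < k → k < d → (j + k) % d ≢ j
[j+k]%d≢j {j} {k} {d} j<d 0<k k<d [j+k]%d≡j with j + k <? d
... | yes j+k<d = <⇒≢ (m<m+n j 0<k) (sym (≡-trans (sym (m<n⇒m%n≡m j+k<d)) [j+k]%d≡j))
... | no j+k≮d = <⇒≢ k<d (+-cancelˡ-≡ j k d (≡-trans (sym wrapped) (cong (_+ d) w≡j)))
  where
  w = j + k ∸ d
  wrapped : w + d ≡ j + k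
  wrapped = m∸n+n≡m (≮⇒≥ j+k≮d)
  w≡j : w ≡ j
  w≡j = begin
    w               ≡⟨ m<n⇒m%n≡m (+-cancelʳ-< d w d (subst (_< d + d) (sym wrapped) (+-mono-< j<d k<d))) ⟨
    w % d           ≡⟨ [m+n]%n≡m%n w d ⟨
    (w + d) % d     ≡⟨ cong (_% d) wrapped ⟩
    (j + k) % d     ≡⟨ [j+k]%d≡j ⟩
    j               ∎
    where open ≡-Reasoning

iter-next-return : ∀ {n} (q : Fin (suc n)) s → iter (suc s) next q ≡ q → n ≤ s
iter-next-return {n} q s returns with s <? n
... | no s≮n = ≮⇒≥ s≮n
... | yes s<n = ⊥-elim ([j+k]%d≢j (FinP.toℕ<n q) (s≤s z≤n) (s≤s s<n)
                         (≡-trans (sym (toℕ-iter-next (suc s) q)) (cong toℕ returns)))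

-- Runs through a simple cycle

module Cycle (P : Program) (C : SimpleCycle P) where
  open SimpleCycle C

  Cfg : Set
  Cfg = Config (m P) (nL P)

  CycleStep : Cfg → Cfg → Set
  CycleStep c c' = ∃[ q ] StepVia (t q) c c'

  data CycleRun : ℕ → Cfg → Cfg → Set where
    []  : ∀ {c} → CycleRun 0 c c
    _∷_ : ∀ {s c c₁ c'} → CycleStep c c₁ → CycleRun s c₁ c' → CycleRun (suc s) c c'

  star⇒cycleRun : ∀ {c c'} → Star CycleStep c c' → ∃[ s ] CycleRun s c c'
  star⇒cycleRun ε = 0 , []
  star⇒cycleRun (step ◅ steps) = let s , run = star⇒cycleRun steps in suc s , step ∷ run

  _++ᶜ_ : ∀ {a b x y z} → CycleRun a x y → CycleRun b y z → CycleRun (a + b) x z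
  [] ++ᶜ run = run
  (step ∷ run) ++ᶜ run' = step ∷ (run ++ᶜ run')

  splitᶜ : ∀ a {b x z} → CycleRun (a + b) x z → ∃[ y ] (CycleRun a x y × CycleRun b y z)
  splitᶜ zero run = _ , [] , run
  splitᶜ (suc a) (step ∷ run) = let y , run₁ , run₂ = splitᶜ a run in y , step ∷ run₁ , run₂

  -- The locations of a simple cycle are pairwise different, so at ℓ q only t q can fire.
  cycleStep-at : ∀ {q q'} c c' → proj₁ c ≡ ℓ q → StepVia (t q') c c' → q' ≡ q × proj₁ c' ≡ ℓ (next q)
  cycleStep-at {q} {q'} c c' at-q (src≡ , tgt≡ , _ , _) = q'≡q , ≡-trans (sym tgt≡) (≡-trans (cong (tgt ∘ t) q'≡q) (t-tgt q))
    where
    q'≡q : q' ≡ q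
    q'≡q = ℓ-inj (≡-trans (sym (t-src q')) (≡-trans src≡ at-q))

  cycleRun-location : ∀ {s c c'} → CycleRun s c c' → ∀ q → proj₁ c ≡ ℓ q → proj₁ c' ≡ ℓ (iter s next q)
  cycleRun-location [] q at-q = at-q
  cycleRun-location (_∷_ {s = s} {c} {c₁} (_ , step) run) q at-q =
    ≡-trans (cycleRun-location run (next q) (proj₂ (cycleStep-at c c₁ at-q step))) (cong ℓ (iter-suc next s q))

  -- →*_C ∘ →_{t_j}, the relation whose k-fold power IsLocalBound counts.
  UpTo : Fin (suc n) → Cfg → Cfg → Set
  UpTo j c c' = ∃[ c'' ] (Star CycleStep c c'' × StepVia (t j) c'' c')

  -- Between two uses of t_j the run goes once around the whole cycle.
  upTo-power⇒cycleRun : ∀ j k {c c'} q → proj₁ c ≡ ℓ q → RelPow (UpTo j) (suc k) c c' →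
                        ∃[ s ] (CycleRun s c c' × k * suc n < s)
  upTo-power⇒cycleRun j zero q at-q (_ , refl , _ , steps , last) =
    let s , run = star⇒cycleRun steps in
    s + 1 , run ++ᶜ ((j , last) ∷ []) , subst (0 <_) (+-comm 1 s) (s≤s z≤n)
  upTo-power⇒cycleRun j (suc k) q at-q (c₁ , power , _ , steps , last)
    with upTo-power⇒cycleRun j k q at-q power | star⇒cycleRun steps
  ... | s₁ , run₁ , k*[n+1]<s₁ | s₂ , run₂ = s₁ + (s₂ + 1) , run₁ ++ᶜ (run₂ ++ᶜ ((j , last) ∷ [])) , bound
    where
    after-j : proj₁ c₁ ≡ ℓ (next j)
    after-j = let (_ , _ , _ , _ , _ , tgt≡ , _) = power in ≡-trans (sym tgt≡) (t-tgt j)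
    back-at-j : ℓ j ≡ ℓ (iter s₂ next (next j))
    back-at-j = ≡-trans (sym (t-src j)) (≡-trans (proj₁ last) (cycleRun-location run₂ (next j) after-j))
    n≤s₂ : n ≤ s₂
    n≤s₂ = iter-next-return j s₂ (sym (≡-trans (ℓ-inj back-at-j) (iter-suc next s₂ j)))
    bound : suc k * suc n < s₁ + (s₂ + 1)
    bound = begin-strict
      suc n + k * suc n  ≡⟨ +-comm (suc n) (k * suc n) ⟩
      k * suc n + suc n  <⟨ +-mono-<-≤ k*[n+1]<s₁ (subst (suc n ≤_) (+-comm 1 s₂) (s≤s n≤s₂)) ⟩
      s₁ + (s₂ + 1)      ∎
      where open ≤-Reasoning

  cycleRun⇒along : ∀ {L c c'} → CycleRun L c c' → ∀ q → proj₁ c ≡ ℓ q → ∀ (g : ℕ → Trans (m P) (nL P)) →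
                   (∀ j → g j ≡ t (iter j next q)) → Along (applyUpTo g L) c c'
  cycleRun⇒along [] q at-q g g≗ = refl
  cycleRun⇒along (_∷_ {c = c} {c₁ = c₁} (_ , step) run) q at-q g g≗ with cycleStep-at c c₁ at-q step
  ... | refl , at-next = c₁ , subst (λ u → StepVia u c c₁) (sym (g≗ 0)) step ,
        cycleRun⇒along run (next q) at-next (g ∘ suc) (λ j → ≡-trans (g≗ (suc j)) (cong t (sym (iter-suc next j q))))

  fullRound-fires : ∀ i {c c'} → CycleRun (suc n) c c' → proj₁ c ≡ ℓ i →
                    Fires (cycleFrom i) (proj₂ c) (proj₂ c') × proj₁ c' ≡ ℓ i
  fullRound-fires i {c} {c'} run at-i =
      subst (λ us → Fires (chain (t i) us) (proj₂ c) (proj₂ c')) (sym rest≡)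
        (along⇒fires-chain (t i) (applyUpTo (around ∘ suc) n)
          (AllP.applyUpTo⁺₂ (around ∘ suc) n (λ j → noTemp⇒pvDetermined (around (suc j)) (noTemp (iter (suc j) next i))))
          (cycleRun⇒along run i at-i around (λ j → refl)))
    , ≡-trans (cycleRun-location run i at-i) (cong ℓ (iter-next-period i))
    where
    around : ℕ → Trans (m P) (nL P)
    around j = t (iter j next i)
    rest≡ : map around (map suc (upTo n)) ≡ applyUpTo (around ∘ suc) n
    rest≡ = ≡-trans (cong (map around) (map-applyUpTo id suc n)) (map-applyUpTo suc around n)

  firstRound : ∀ {s c c'} → suc n ≤ s → CycleRun s c c' →
               ∃[ c₁ ] (CycleRun (suc n) c c₁ × CycleRun (s ∸ suc n) c₁ c')
  firstRound {s} {c} n+1≤s run = splitᶜ (suc n) (subst (λ z → CycleRun z c _) (sym (m+[n∸m]≡n n+1≤s)) run)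

  module _ {r : Trans (m P) (nL P)} {e : InE P C r} (ch : Choice P C r e) where
    open Choice ch
    private i = InE.i e

    loopVars : State (m P) → Fin d → ℤ
    loopVars σ k = σ (inj₁ (π ⟨$⟩ˡ ι k))

    private
      unrename : State (m P) → State (m P)
      unrename σ (inj₁ w) = σ (inj₁ (π ⟨$⟩ˡ w))
      unrename σ (inj₂ u) = σ (inj₂ u)

      unrename-renV : ∀ σ v → unrename σ (renV P C π v) ≡ σ v
      unrename-renV σ (inj₁ v) = cong (λ w → σ (inj₁ w)) (inverseˡ π)
      unrename-renV σ (inj₂ u) = refl

    round⇒loopStep : ∀ σ σ' → Fires (cycleFrom i) σ σ' →
                     holds (loopVars σ) φL × (∀ k → loopVars σ' k ≡ evalP (loopVars σ) (ηL k))
    round⇒loopStep σ σ' (g , u) = guard-holds , update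
      where
      guard-holds : holds (loopVars σ) φL
      guard-holds = coerce (holds-mapF (inj₁ ∘ ι) (unrename σ) φL)
        (holds-FormEq (unrename σ) φπ _ φ-in
          (coerce (sym (≡-trans (holds-mapF (renV P C π) (unrename σ) (guard (cycleFrom i)))
                                (holds-cong (unrename-renV σ) (guard (cycleFrom i))))) g))
      update : ∀ k → loopVars σ' k ≡ evalP (loopVars σ) (ηL k)
      update k = begin
        loopVars σ' k                          ≡⟨ u (π ⟨$⟩ˡ ι k) ⟩
        evalP σ tₖ                             ≡⟨ evalP-cong (unrename-renV σ) tₖ ⟨
        evalP (unrename σ ∘ renV P C π) tₖ     ≡⟨ evalP-mapP (renV P C π) (unrename σ) tₖ ⟨
        evalP (unrename σ) (ηπ (ι k))          ≡⟨ η-tri k (unrename σ) ⟩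
        evalP (loopVars σ) (ηL k)              ∎
        where
        open ≡-Reasoning
        tₖ = upd (cycleFrom i) (π ⟨$⟩ˡ ι k)

    -- Every full round of the cycle from ℓ_i is one iteration of the loop L.
    cycleRun⇒guards : ∀ M s {c c'} → M * suc n ≤ s → CycleRun s c c' → proj₁ c ≡ ℓ i →
                      ∀ k → k < M → holds (iterUpd ηL k (loopVars (proj₂ c))) φL
    cycleRun⇒guards (suc M) s {c} M*[n+1]≤s run at-i k k<M
      with firstRound (≤-trans (m≤m+n (suc n) (M * suc n)) M*[n+1]≤s) run
    ... | c₁ , round , later with fullRound-fires i round at-i
    ... | fires , at-i' with round⇒loopStep (proj₂ c) (proj₂ c₁) fires | k
    ... | guard-holds , _ | zero = guard-holds
    ... | _ , update | suc k' =
      coerce (holds-cong (λ j → sym (≡-trans (iterUpd-suc ηL k' (loopVars (proj₂ c)) j)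
                                             (iterUpd-cong ηL k' (λ j → sym (update j)) j))) φL)
        (cycleRun⇒guards M (s ∸ suc n) (subst (_≤ s ∸ suc n) (m+n∸m≡n (suc n) (M * suc n)) (∸-monoˡ-≤ (suc n) M*[n+1]≤s))
          later at-i' k' (≤-pred k<M))

-- Sign of exponential-polynomial sums

0<A+[1+k]*F : ∀ A F k → ∣ A ∣ < F → + 0 ℤ.< A ℤ.+ + suc k ℤ.* + F
0<A+[1+k]*F A F k ∣A∣<F = subst (λ z → + 0 ℤ.< A ℤ.+ z) (ℤP.pos-* (suc k) F) (positive A (suc k * F) ∣A∣<[1+k]F)
  where
  ∣A∣<[1+k]F : ∣ A ∣ < suc k * F
  ∣A∣<[1+k]F = <-≤-trans ∣A∣<F (m≤m+n F (k * F))
  positive : ∀ A G → ∣ A ∣ < G → + 0 ℤ.< A ℤ.+ + G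
  positive (+ a) G ∣A∣<G = ℤ.+<+ (≤-trans (≤-trans (s≤s z≤n) ∣A∣<G) (m≤n+m G a))
  positive -[1+ a ] G ∣A∣<G = subst (+ 0 ℤ.<_) (sym (ℤP.⊖-≥ (<⇒≤ ∣A∣<G))) (ℤ.+<+ (m<n⇒0<n∸m ∣A∣<G))

A-[1+k]*F<0 : ∀ A F k → ∣ A ∣ < F → A ℤ.+ -[1+ k ] ℤ.* + F ℤ.< + 0
A-[1+k]*F<0 A F k ∣A∣<F = subst₂ ℤ._<_ negated refl (ℤP.neg-mono-< (0<A+[1+k]*F (ℤ.- A) F k ∣-A∣<F))
  where
  ∣-A∣<F : ∣ ℤ.- A ∣ < F
  ∣-A∣<F = subst (_< F) (sym (ℤP.∣-i∣≡∣i∣ A)) ∣A∣<F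
  negated : ℤ.- (ℤ.- A ℤ.+ + suc k ℤ.* + F) ≡ A ℤ.+ -[1+ k ] ℤ.* + F
  negated = ≡-trans (ℤP.neg-distrib-+ (ℤ.- A) _)
                    (cong₂ ℤ._+_ (ℤP.neg-involutive A) (ℤP.neg-distribˡ-* (+ suc k) (+ F)))

-- 1-based indexing, matching keyAt; index 0 and indices past the end give the default.
getAt : ∀ {A : Set} → A → List A → ℕ → A
getAt z [] _ = z
getAt z (x ∷ xs) zero = z
getAt z (x ∷ xs) (suc zero) = x
getAt z (x ∷ xs) (suc (suc j)) = getAt z xs (suc j)

keyAt-map : ∀ {A : Set} (f : A → ℕ × ℕ) (z : A) → f z ≡ (0 , 0) → ∀ xs j → keyAt (map f xs) j ≡ f (getAt z xs j)
keyAt-map f z fz≡0 [] j = sym fz≡0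
keyAt-map f z fz≡0 (x ∷ xs) zero = sym fz≡0
keyAt-map f z fz≡0 (x ∷ xs) (suc zero) = refl
keyAt-map f z fz≡0 (x ∷ xs) (suc (suc j)) = keyAt-map f z fz≡0 xs (suc j)

-- sumTo h m = h 1 + ⋯ + h m
sumTo : (ℕ → ℤ) → ℕ → ℤ
sumTo h zero = + 0
sumTo h (suc m) = sumTo h m ℤ.+ h (suc m)

sumToℕ : (ℕ → ℕ) → ℕ → ℕ
sumToℕ h zero = 0
sumToℕ h (suc m) = sumToℕ h m + h (suc m)

sumTo-suc : ∀ h m → sumTo h (suc m) ≡ h 1 ℤ.+ sumTo (h ∘ suc) m
sumTo-suc h zero = ≡-trans (ℤP.+-identityˡ (h 1)) (sym (ℤP.+-identityʳ (h 1)))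
sumTo-suc h (suc m) = ≡-trans (cong (ℤ._+ h (suc (suc m))) (sumTo-suc h m))
                             (ℤP.+-assoc (h 1) (sumTo (h ∘ suc) m) (h (suc (suc m))))

sumTo-cong : ∀ {h h'} → (∀ j → h (suc j) ≡ h' (suc j)) → ∀ m → sumTo h m ≡ sumTo h' m
sumTo-cong h≗h' zero = refl
sumTo-cong h≗h' (suc m) = cong₂ ℤ._+_ (sumTo-cong h≗h' m) (h≗h' m)

sumZ-map≡sumTo : ∀ {A : Set} (z : A) (h : A → ℤ) xs → sumZ (map h xs) ≡ sumTo (h ∘ getAt z xs) (length xs)
sumZ-map≡sumTo z h [] = refl
sumZ-map≡sumTo z h (x ∷ xs) =
  ≡-trans (cong (λ s → h x ℤ.+ s) (≡-trans (sumZ-map≡sumTo z h xs) (sumTo-cong (λ _ → refl) (length xs))))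
          (sym (sumTo-suc (h ∘ getAt z (x ∷ xs)) (length xs)))

sumToℕ-≤ : ∀ h m X → (∀ i → 1 ≤ i → i ≤ m → h i ≤ X) → sumToℕ h m ≤ m * X
sumToℕ-≤ h zero X h≤X = z≤n
sumToℕ-≤ h (suc m) X h≤X = subst (sumToℕ h m + h (suc m) ≤_) (+-comm (m * X) X)
  (+-mono-≤ (sumToℕ-≤ h m X (λ i 1≤i i≤m → h≤X i 1≤i (m≤n⇒m≤1+n i≤m))) (h≤X (suc m) (s≤s z≤n) ≤-refl))

sumToℕ-zero : ∀ h m → (∀ i → 1 ≤ i → i ≤ m → h i ≡ 0) → sumToℕ h m ≡ 0
sumToℕ-zero h zero h≡0 = refl
sumToℕ-zero h (suc m) h≡0 =
  cong₂ _+_ (sumToℕ-zero h m (λ i 1≤i i≤m → h≡0 i 1≤i (m≤n⇒m≤1+n i≤m))) (h≡0 (suc m) (s≤s z≤n) ≤-refl)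

>lex-trans : ∀ {p q r} → p >lex q → q >lex r → p >lex r
>lex-trans (inj₁ b<) (inj₁ b<') = inj₁ (<-trans b<' b<)
>lex-trans (inj₁ b<) (inj₂ (refl , _)) = inj₁ b<
>lex-trans (inj₂ (refl , _)) (inj₁ b<') = inj₁ b<'
>lex-trans (inj₂ (refl , a<)) (inj₂ (refl , a<')) = inj₂ (refl , <-trans a<' a<)

>lex⇒base-≥ : ∀ {p q} → p >lex q → proj₁ q ≤ proj₁ p
>lex⇒base-≥ (inj₁ b<) = <⇒≤ b<
>lex⇒base-≥ (inj₂ (b≡ , _)) = ≤-reflexive (sym b≡)

linked⇒getAt : ∀ {A : Set} {R : A → A → Set} → (∀ {x y z} → R x y → R y z → R x z) → (z : A) → ∀ {xs} → Linked R xs →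
               ∀ i j → 1 ≤ i → i < j → j ≤ length xs → R (getAt z xs i) (getAt z xs j)
linked⇒getAt R-trans z {x ∷ y ∷ ys} (r ∷ _) 1 2 _ _ _ = r
linked⇒getAt R-trans z {x ∷ y ∷ ys} (r ∷ rs) 1 (suc (suc (suc j))) _ _ (s≤s j≤) =
  R-trans r (linked⇒getAt R-trans z rs 1 (suc (suc j)) (s≤s z≤n) (s≤s (s≤s z≤n)) j≤)
linked⇒getAt R-trans z {x ∷ xs} rs (suc (suc i)) (suc (suc j)) _ (s≤s i<j) (s≤s j≤) =
  linked⇒getAt R-trans z (Linked.tail rs) (suc i) (suc j) (s≤s z≤n) i<j j≤
linked⇒getAt R-trans z {x ∷ []} _ 1 (suc (suc j)) _ _ (s≤s ())
linked⇒getAt R-trans z _ 1 1 _ (s≤s ()) _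
linked⇒getAt R-trans z {[]} _ i (suc j) _ _ ()

maxL-base : ∀ z xs → z ≤ maxL z xs
maxL-base z [] = ≤-refl
maxL-base z (x ∷ xs) = ≤-trans (maxL-base z xs) (m≤n⊔m x _)

∈⇒≤maxL-map : ∀ {A : Set} {z} (g : A → ℕ) {y xs} → y ∈ xs → g y ≤ maxL z (map g xs)
∈⇒≤maxL-map g {xs = x ∷ xs} (here refl) = m≤m⊔n (g x) _
∈⇒≤maxL-map g {xs = x ∷ xs} (there y∈xs) = ≤-trans (∈⇒≤maxL-map g y∈xs) (m≤n⊔m (g x) _)

-- The thresholds M_{m+1} and (inside N_{m+2}) mt, mt′ of the paper's C_α, for keys key 1, …, key ℓ.
record ThresholdsBelow (th : ℕ → ℕ × ℕ → ℕ × ℕ → ℕ) (key : ℕ → ℕ × ℕ) (ℓ C : ℕ) : Set where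
  field
    M-threshold : ∀ m → 1 ≤ m → suc m ≤ ℓ → proj₁ (key (suc m)) ≢ proj₁ (key m) →
                  th 1 (key (suc m)) (proj₁ (key m) , suc (proj₂ (key m))) ≤ C
    mt-threshold : ∀ m i → 1 ≤ i → i < m → suc (suc m) ≤ ℓ → th 1 (key m) (key i) ≤ C
    mt′-threshold : ∀ m → 1 ≤ m → suc (suc m) ≤ ℓ → th m (key (suc m)) (key m) ≤ C

module _ (th : ℕ → ℕ × ℕ → ℕ × ℕ → ℕ) (ks : List (ℕ × ℕ)) where
  private
    kk = keyAt ks
    -- Copies of the local definitions M_j, N_j of Cα, which cannot be named from outside.
    Mj : ℕ → ℕ
    Mj j = if proj₁ (kk j) ℕ.≡ᵇ proj₁ (kk (j ∸ 1)) then 0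
           else th 1 (kk j) (proj₁ (kk (j ∸ 1)) , suc (proj₂ (kk (j ∸ 1))))
    Nj : ℕ → ℕ
    Nj 2 = 1
    Nj j = maxL 0 (map (λ i → th 1 (kk (j ∸ 2)) (kk i)) (map suc (upTo (j ∸ 3))))
           ⊔ th (j ∸ 2) (kk (j ∸ 1)) (kk (j ∸ 2))

    summand≤Cα : ∀ j → 2 ≤ j → j ≤ length ks → Nj j ⊔ Mj j ≤ Cα th ks
    summand≤Cα (suc zero) (s≤s ()) _
    summand≤Cα (suc (suc zero)) _ 2≤ = ∈⇒≤maxL-map _ (∈-map⁺ (λ k → 2 + k) (∈-upTo⁺ (k<L 2≤)))
      where
      k<L : ∀ {L} → 2 ≤ L → 0 < L ∸ 1
      k<L (s≤s k+1≤) = k+1≤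
    summand≤Cα (suc (suc (suc k))) _ k+3≤ = ∈⇒≤maxL-map _ (∈-map⁺ (λ k → 2 + k) (∈-upTo⁺ (k<L k+3≤)))
      where
      k<L : ∀ {L} → 3 + k ≤ L → suc k < L ∸ 1
      k<L (s≤s k+2≤) = k+2≤

  1≤Cα : 1 ≤ Cα th ks
  1≤Cα = maxL-base 1 (map _ (map (λ k → 2 + k) (upTo (length ks ∸ 1))))

  Cα-thresholdsBelow : ∀ {C} → Cα th ks ≤ C → ThresholdsBelow th kk (length ks) C
  Cα-thresholdsBelow {C} Cα≤C = record
    { M-threshold = λ m 1≤m m+1≤ℓ b≢ → ≤-trans (≤-reflexive (sym (Mj≡ m b≢)))
                      (≤-trans (m≤n⊔m _ _) (≤-trans (summand≤Cα (suc m) (s≤s 1≤m) m+1≤ℓ) Cα≤C))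
    ; mt-threshold = mt-threshold
    ; mt′-threshold = mt′-threshold
    }
    where
    N≤C : ∀ m → suc (suc (suc m)) ≤ length ks → Nj (suc (suc (suc m))) ≤ C
    N≤C m m+3≤ℓ = ≤-trans (m≤m⊔n _ _) (≤-trans (summand≤Cα (suc (suc (suc m))) (s≤s (s≤s z≤n)) m+3≤ℓ) Cα≤C)
    mt-threshold : ∀ m i → 1 ≤ i → i < m → suc (suc m) ≤ length ks → th 1 (kk m) (kk i) ≤ C
    mt-threshold (suc m) (suc i) _ (s≤s i<m) m+3≤ℓ =
      ≤-trans (∈⇒≤maxL-map (λ i → th 1 (kk (suc m)) (kk i)) (∈-map⁺ suc (∈-upTo⁺ i<m)))
              (≤-trans (m≤m⊔n _ _) (N≤C m m+3≤ℓ))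
    mt′-threshold : ∀ m → 1 ≤ m → suc (suc m) ≤ length ks → th m (kk (suc m)) (kk m) ≤ C
    mt′-threshold (suc m) _ m+3≤ℓ = ≤-trans (m≤n⊔m _ _) (N≤C m m+3≤ℓ)
    Mj≡ : ∀ m → proj₁ (kk (suc m)) ≢ proj₁ (kk m) → Mj (suc m) ≡ th 1 (kk (suc m)) (proj₁ (kk m) , suc (proj₂ (kk m)))
    Mj≡ m b≢ with proj₁ (kk (suc m)) ℕ.≡ᵇ proj₁ (kk m) in eq
    ... | true = ⊥-elim (b≢ (≡ᵇ⇒≡ _ _ (subst Bool.T (sym eq) _)))
    ... | false = refl

-- For n ≥ 2P + C the last summand with nonzero base dominates, so the sign of
-- Σ_{j ≤ ℓ} coeff_j n^{a_j} b_j^n no longer changes.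
module SignStabilization
  (th : ℕ → ℕ × ℕ → ℕ × ℕ → ℕ) (th-ok : ThresholdFn th)
  (ℓ : ℕ) (key : ℕ → ℕ × ℕ) (coeff : ℕ → ℤ)
  (sorted : ∀ i j → 1 ≤ i → i < j → j ≤ ℓ → key j >lex key i)
  (P : ℕ) (coeff≤P : ∀ j → 1 ≤ j → suc j ≤ ℓ → ∣ coeff j ∣ ≤ P)
  (C : ℕ) (1≤C : 1 ≤ C) (thresholds : ThresholdsBelow th key ℓ C) where

  open ThresholdsBelow thresholds

  b a : ℕ → ℕ
  b j = proj₁ (key j)
  a j = proj₂ (key j)

  f : ℕ → ℕ → ℕ
  f j n = nab n (a j) (b j)

  partial : ℕ → ℕ → ℤ
  partial m n = sumTo (λ j → coeff j ℤ.* + f j n) m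

  partialℕ : ℕ → ℕ → ℕ
  partialℕ m n = sumToℕ (λ j → f j n) m

  V : ℕ
  V = 2 * P + C

  private
    C≤V : C ≤ V
    C≤V = m≤n+m C (2 * P)

    1≤n : ∀ {n} → V ≤ n → 1 ≤ n
    1≤n V≤n = ≤-trans 1≤C (≤-trans C≤V V≤n)

  b-mono : ∀ i j → 1 ≤ i → i ≤ j → j ≤ ℓ → b i ≤ b j
  b-mono i j 1≤i i≤j j≤ℓ with m≤n⇒m<n∨m≡n i≤j
  ... | inj₁ i<j = >lex⇒base-≥ (sorted i j 1≤i i<j j≤ℓ)
  ... | inj₂ refl = ≤-refl

  f-zero : ∀ i n → 1 ≤ n → b i ≡ 0 → f i n ≡ 0
  f-zero i n 1≤n b≡0 = subst (λ z → nab n (a i) z ≡ 0) (sym b≡0) (nab-zeroʳ n (a i) 1≤n)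

  n*f≤f-next : ∀ m n → 1 ≤ m → suc m ≤ ℓ → V ≤ n → n * f m n ≤ f (suc m) n
  n*f≤f-next m n 1≤m m+1≤ℓ V≤n with sorted m (suc m) 1≤m ≤-refl m+1≤ℓ | b (suc m) ℕ.≟ b m
  ... | inj₁ b< | yes b≡ = ⊥-elim (<-irrefl (sym b≡) b<)
  ... | inj₂ (b≡ , _) | no b≢ = ⊥-elim (b≢ b≡)
  ... | inj₂ (_ , a<) | yes b≡ = begin
      n * (n ^ a m * b m ^ n)         ≡⟨ *-assoc n (n ^ a m) (b m ^ n) ⟨
      n ^ suc (a m) * b m ^ n         ≤⟨ *-monoˡ-≤ (b m ^ n) (^-monoʳ-≤ n {{ℕ.>-nonZero (1≤n V≤n)}} a<) ⟩
      n ^ a (suc m) * b m ^ n         ≡⟨ cong (λ z → n ^ a (suc m) * z ^ n) b≡ ⟨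
      n ^ a (suc m) * b (suc m) ^ n   ∎
    where open ≤-Reasoning
  ... | inj₁ b< | no b≢ = begin
      n * (n ^ a m * b m ^ n)         ≡⟨ *-assoc n (n ^ a m) (b m ^ n) ⟨
      n ^ suc (a m) * b m ^ n         ≡⟨ +-identityʳ _ ⟨
      1 * nab n (suc (a m)) (b m)     ≤⟨ <⇒≤ (threshold-beyond th-ok 1 (b (suc m)) (a (suc m)) (b m) (suc (a m))
                                              (≤-trans (s≤s z≤n) b<) (inj₁ b<) n
                                              (≤-trans (M-threshold m 1≤m m+1≤ℓ b≢) (≤-trans C≤V V≤n))) ⟩
      f (suc m) n                     ∎
    where open ≤-Reasoning

  partialℕ≤f-next : ∀ m n → 1 ≤ m → suc (suc m) ≤ ℓ → V ≤ n → partialℕ m n ≤ f (suc m) n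
  partialℕ≤f-next m n 1≤m m+2≤ℓ V≤n with b m ℕ.≟ 0
  ... | yes b≡0 = ≤-trans (≤-reflexive (sumToℕ-zero (λ j → f j n) m all-zero)) z≤n
    where
    all-zero : ∀ i → 1 ≤ i → i ≤ m → f i n ≡ 0
    all-zero i 1≤i i≤m = f-zero i n (1≤n V≤n)
      (n≤0⇒n≡0 (subst (b i ≤_) b≡0 (b-mono i m 1≤i i≤m (≤-trans (n≤1+n m) (≤-trans (n≤1+n (suc m)) m+2≤ℓ)))))
  ... | no b≢0 = ≤-trans (sumToℕ-≤ (λ j → f j n) m (f m n) each≤) (<⇒≤ m*f<f-next)
    where
    m≤ℓ : m ≤ ℓ
    m≤ℓ = ≤-trans (n≤1+n m) (≤-trans (n≤1+n (suc m)) m+2≤ℓ)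
    each≤ : ∀ i → 1 ≤ i → i ≤ m → f i n ≤ f m n
    each≤ i 1≤i i≤m with m≤n⇒m<n∨m≡n i≤m
    ... | inj₂ refl = ≤-refl
    ... | inj₁ i<m = ≤-trans (≤-reflexive (sym (+-identityʳ (f i n))))
      (<⇒≤ (threshold-beyond th-ok 1 (b m) (a m) (b i) (a i) (n≢0⇒n>0 b≢0) (sorted i m 1≤i i<m m≤ℓ) n
              (≤-trans (mt-threshold m i 1≤i i<m m+2≤ℓ) (≤-trans C≤V V≤n))))
    m*f<f-next : m * f m n < f (suc m) n
    m*f<f-next = threshold-beyond th-ok m (b (suc m)) (a (suc m)) (b m) (a m)
      (≤-trans (n≢0⇒n>0 b≢0) (b-mono m (suc m) 1≤m (n≤1+n m) (≤-trans (n≤1+n (suc m)) m+2≤ℓ)))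
      (sorted m (suc m) 1≤m ≤-refl (≤-trans (n≤1+n (suc m)) m+2≤ℓ)) n
      (≤-trans (mt′-threshold m 1≤m m+2≤ℓ) (≤-trans C≤V V≤n))

  partialℕ≤2*f : ∀ m n → 1 ≤ m → m < ℓ → V ≤ n → partialℕ m n ≤ 2 * f m n
  partialℕ≤2*f (suc zero) n _ _ _ = m≤m+n (f 1 n) _
  partialℕ≤2*f (suc (suc m)) n _ m+3≤ℓ V≤n = begin
    partialℕ (suc m) n + f (suc (suc m)) n       ≤⟨ +-monoˡ-≤ _ (partialℕ≤f-next (suc m) n (s≤s z≤n) m+3≤ℓ V≤n) ⟩
    f (suc (suc m)) n + f (suc (suc m)) n        ≡⟨ cong (λ z → f (suc (suc m)) n + z) (+-identityʳ _) ⟨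
    2 * f (suc (suc m)) n                        ∎
    where open ≤-Reasoning

  ∣partial∣≤P*partialℕ : ∀ m n → suc m ≤ ℓ → ∣ partial m n ∣ ≤ P * partialℕ m n
  ∣partial∣≤P*partialℕ zero n _ = z≤n
  ∣partial∣≤P*partialℕ (suc m) n m+2≤ℓ = begin
      ∣ partial m n ℤ.+ coeff (suc m) ℤ.* + f (suc m) n ∣
    ≤⟨ ℤP.∣i+j∣≤∣i∣+∣j∣ (partial m n) _ ⟩
      ∣ partial m n ∣ + ∣ coeff (suc m) ℤ.* + f (suc m) n ∣
    ≡⟨ cong (λ z → ∣ partial m n ∣ + z) (ℤP.abs-* (coeff (suc m)) (+ f (suc m) n)) ⟩
      ∣ partial m n ∣ + ∣ coeff (suc m) ∣ * f (suc m) n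
    ≤⟨ +-mono-≤ (∣partial∣≤P*partialℕ m n (≤-trans (n≤1+n (suc m)) m+2≤ℓ))
                (*-monoˡ-≤ (f (suc m) n) (coeff≤P (suc m) (s≤s z≤n) m+2≤ℓ)) ⟩
      P * partialℕ m n + P * f (suc m) n
    ≡⟨ *-distribˡ-+ P (partialℕ m n) (f (suc m) n) ⟨
      P * partialℕ (suc m) n
    ∎
    where open ≤-Reasoning

  partial-zero : ∀ m n → 1 ≤ n → (∀ i → 1 ≤ i → i ≤ m → b i ≡ 0) → partial m n ≡ + 0
  partial-zero zero n _ _ = refl
  partial-zero (suc m) n 1≤n b≡0 = begin
    partial m n ℤ.+ coeff (suc m) ℤ.* + f (suc m) n
      ≡⟨ cong₂ (λ s z → s ℤ.+ coeff (suc m) ℤ.* + z)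
               (partial-zero m n 1≤n (λ i 1≤i i≤m → b≡0 i 1≤i (m≤n⇒m≤1+n i≤m)))
               (f-zero (suc m) n 1≤n (b≡0 (suc m) (s≤s z≤n) ≤-refl)) ⟩
    + 0 ℤ.+ coeff (suc m) ℤ.* + 0
      ≡⟨ ℤP.+-identityˡ _ ⟩
    coeff (suc m) ℤ.* + 0
      ≡⟨ ℤP.*-zeroʳ (coeff (suc m)) ⟩
    + 0
      ∎
    where open ≡-Reasoning

  P*partialℕ<f-next : ∀ m n → suc m ≤ ℓ → 1 ≤ b (suc m) → V ≤ n → P * partialℕ m n < f (suc m) n
  P*partialℕ<f-next zero n _ 1≤b V≤n = subst (_< f 1 n) (sym (*-zeroʳ P)) (nab-pos n (a 1) (b 1) (1≤n V≤n) 1≤b)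
  P*partialℕ<f-next (suc m) n m+2≤ℓ 1≤b V≤n with f (suc m) n ℕ.≟ 0
  ... | yes f≡0 = subst (_< f (suc (suc m)) n) (sym P*partialℕ≡0) (nab-pos n (a (suc (suc m))) (b (suc (suc m))) (1≤n V≤n) 1≤b)
    where
    P*partialℕ≡0 : P * partialℕ (suc m) n ≡ 0
    P*partialℕ≡0 = ≡-trans (cong (P *_) (n≤0⇒n≡0 (subst (partialℕ (suc m) n ≤_) (cong (2 *_) f≡0)
                             (partialℕ≤2*f (suc m) n (s≤s z≤n) m+2≤ℓ V≤n))))
                           (*-zeroʳ P)
  ... | no f≢0 = begin-strict
      P * partialℕ (suc m) n
    ≤⟨ *-monoʳ-≤ P (partialℕ≤2*f (suc m) n (s≤s z≤n) m+2≤ℓ V≤n) ⟩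
      P * (2 * F)
    ≡⟨ ≡-trans (sym (*-assoc P 2 F)) (cong (_* F) (*-comm P 2)) ⟩
      2 * P * F
    <⟨ m<m+n (2 * P * F) (n≢0⇒n>0 f≢0) ⟩
      2 * P * F + F
    ≡⟨ +-comm (2 * P * F) F ⟩
      suc (2 * P) * F
    ≤⟨ *-monoˡ-≤ F (≤-trans (≤-reflexive (+-comm 1 (2 * P))) (≤-trans (+-monoʳ-≤ (2 * P) 1≤C) V≤n)) ⟩
      n * F
    ≤⟨ n*f≤f-next (suc m) n (s≤s z≤n) m+2≤ℓ V≤n ⟩
      f (suc (suc m)) n
    ∎
    where
    open ≤-Reasoning
    F = f (suc m) n

  SignStable : (ℕ → ℤ) → Set
  SignStable h = (∀ n → V ≤ n → + 0 ℤ.< h n) ⊎ (∀ n → V ≤ n → h n ℤ.≤ + 0)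

  partial-signStable : ∀ m → m ≤ ℓ → SignStable (partial m)
  partial-signStable zero _ = inj₂ (λ _ _ → ℤP.≤-refl)
  partial-signStable (suc m) m+1≤ℓ with coeff (suc m) ℤ.≟ + 0 | b (suc m) ℕ.≟ 0
  ... | yes coeff≡0 | _ = case partial-signStable m (≤-trans (n≤1+n m) m+1≤ℓ) of λ where
      (inj₁ pos) → inj₁ (λ n V≤n → subst (+ 0 ℤ.<_) (unchanged n) (pos n V≤n))
      (inj₂ nonpos) → inj₂ (λ n V≤n → subst (ℤ._≤ + 0) (unchanged n) (nonpos n V≤n))
    where
    unchanged : ∀ n → partial m n ≡ partial (suc m) n
    unchanged n = sym (≡-trans (cong (λ c → partial m n ℤ.+ c ℤ.* + f (suc m) n) coeff≡0) (ℤP.+-identityʳ (partial m n)))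
  ... | no _ | yes b≡0 = inj₂ (λ n V≤n → ℤP.≤-reflexive (partial-zero (suc m) n (1≤n V≤n)
                            (λ i 1≤i i≤m+1 → n≤0⇒n≡0 (subst (b i ≤_) b≡0 (b-mono i (suc m) 1≤i i≤m+1 m+1≤ℓ)))))
  ... | no coeff≢0 | no b≢0 = by-sign (coeff (suc m)) refl
    where
    rest<last : ∀ n → V ≤ n → ∣ partial m n ∣ < f (suc m) n
    rest<last n V≤n = ≤-<-trans (∣partial∣≤P*partialℕ m n m+1≤ℓ) (P*partialℕ<f-next m n m+1≤ℓ (n≢0⇒n>0 b≢0) V≤n)
    by-sign : ∀ c → coeff (suc m) ≡ c → SignStable (partial (suc m))
    by-sign (+ zero) c≡ = ⊥-elim (coeff≢0 c≡)
    by-sign (+ suc k) c≡ = inj₁ λ n V≤n → subst (λ c → + 0 ℤ.< partial m n ℤ.+ c ℤ.* + f (suc m) n) (sym c≡)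
      (0<A+[1+k]*F (partial m n) (f (suc m) n) k (rest<last n V≤n))
    by-sign -[1+ k ] c≡ = inj₂ λ n V≤n → subst (λ c → partial m n ℤ.+ c ℤ.* + f (suc m) n ℤ.≤ + 0) (sym c≡)
      (ℤP.<⇒≤ (A-[1+k]*F<0 (partial m n) (f (suc m) n) k (rest<last n V≤n)))

-- The bound ⊔ Pol

evalB-mapB : ∀ {V W : Set} (f : V → W) (ρ : W → ℕ) b → evalB ρ (mapB f b) ≡ evalB (ρ ∘ f) b
evalB-mapB f ρ (bn k) = refl
evalB-mapB f ρ bω = refl
evalB-mapB f ρ (bv v) = refl
evalB-mapB f ρ (a b+ b) = cong₂ (lift2 _+_) (evalB-mapB f ρ a) (evalB-mapB f ρ b)
evalB-mapB f ρ (a b* b) = cong₂ (lift2 _*_) (evalB-mapB f ρ a) (evalB-mapB f ρ b)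
evalB-mapB f ρ (bexp k b) rewrite evalB-mapB f ρ b = refl

monoℕ : ∀ {d} → (Fin d → ℕ) → Vec ℕ d → ℕ
monoℕ ρ [] = 1
monoℕ ρ (e ∷ es) = ρ Fin.zero ^ e * monoℕ (ρ ∘ Fin.suc) es

evalB-powB : ∀ {V : Set} (ρ : V → ℕ) v e → evalB ρ (powB (bv v) e) ≡ just (ρ v ^ e)
evalB-powB ρ v zero = refl
evalB-powB ρ v (suc e) rewrite evalB-powB ρ v e = refl

evalB-monoB : ∀ {d} (ρ : Fin d → ℕ) e → evalB ρ (monoB e) ≡ just (monoℕ ρ e)
evalB-monoB ρ [] = refl
evalB-monoB ρ (e ∷ es)
  rewrite evalB-powB ρ Fin.zero e | evalB-mapB Fin.suc ρ (monoB es) | evalB-monoB (ρ ∘ Fin.suc) es = refl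

module _ {d : ℕ} where

  _≟ᵉ_ : (u v : Vec ℕ d) → Dec (u ≡ v)
  _≟ᵉ_ = VecP.≡-dec ℕ._≟_

  exponents : List (ZPoly d) → List (Vec ℕ d)
  exponents qs = deduplicate _≟ᵉ_ (concatMap (map proj₂) qs)

  maxCoef : List (ZPoly d) → Vec ℕ d → ℕ
  maxCoef qs e = maxL 0 (map (λ q → ∣ coef q e ∣) qs)

  sqcupℕ : (Fin d → ℕ) → List (ZPoly d) → ℕ
  sqcupℕ ρ qs = foldr _+_ 0 (map (λ e → maxCoef qs e * monoℕ ρ e) (exponents qs))

  evalB-sqcup : ∀ (ρ : Fin d → ℕ) qs → evalB ρ (sqcup qs) ≡ just (sqcupℕ ρ qs)
  evalB-sqcup ρ qs = sum (exponents qs)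
    where
    sum : ∀ es → evalB ρ (foldr _b+_ (bn 0) (map (λ e → bn (maxCoef qs e) b* monoB e) es))
                 ≡ just (foldr _+_ 0 (map (λ e → maxCoef qs e * monoℕ ρ e) es))
    sum [] = refl
    sum (e ∷ es) rewrite evalB-monoB ρ e | sum es = refl

sumZ-map-+ : ∀ {A : Set} (h₁ h₂ : A → ℤ) xs → sumZ (map (λ e → h₁ e ℤ.+ h₂ e) xs) ≡ sumZ (map h₁ xs) ℤ.+ sumZ (map h₂ xs)
sumZ-map-+ h₁ h₂ [] = refl
sumZ-map-+ h₁ h₂ (x ∷ xs) rewrite sumZ-map-+ h₁ h₂ xs = interchange (h₁ x) (h₂ x) (sumZ (map h₁ xs)) (sumZ (map h₂ xs))
  where
  interchange : ∀ a b c d → a ℤ.+ b ℤ.+ (c ℤ.+ d) ≡ a ℤ.+ c ℤ.+ (b ℤ.+ d)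
  interchange = solveℤ

sumZ-map-cong : ∀ {A : Set} {h₁ h₂ : A → ℤ} xs → (∀ e → e ∈ xs → h₁ e ≡ h₂ e) → sumZ (map h₁ xs) ≡ sumZ (map h₂ xs)
sumZ-map-cong [] _ = refl
sumZ-map-cong (x ∷ xs) h₁≗h₂ = cong₂ ℤ._+_ (h₁≗h₂ x (here refl)) (sumZ-map-cong xs (λ e e∈ → h₁≗h₂ e (there e∈)))

sumZ-map-zero : ∀ {A : Set} (h : A → ℤ) xs → (∀ e → e ∈ xs → h e ≡ + 0) → sumZ (map h xs) ≡ + 0
sumZ-map-zero h [] _ = refl
sumZ-map-zero h (x ∷ xs) h≡0 = cong₂ ℤ._+_ (h≡0 x (here refl)) (sumZ-map-zero h xs (λ e e∈ → h≡0 e (there e∈)))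

∣sumZ-map∣≤ : ∀ {A : Set} (h : A → ℤ) xs → ∣ sumZ (map h xs) ∣ ≤ foldr _+_ 0 (map (λ e → ∣ h e ∣) xs)
∣sumZ-map∣≤ h [] = z≤n
∣sumZ-map∣≤ h (y ∷ xs) = ≤-trans (ℤP.∣i+j∣≤∣i∣+∣j∣ (h y) _) (+-monoʳ-≤ ∣ h y ∣ (∣sumZ-map∣≤ h xs))

sumℕ-map-mono : ∀ {A : Set} (h₁ h₂ : A → ℕ) xs → (∀ e → h₁ e ≤ h₂ e) → foldr _+_ 0 (map h₁ xs) ≤ foldr _+_ 0 (map h₂ xs)
sumℕ-map-mono h₁ h₂ [] _ = z≤n
sumℕ-map-mono h₁ h₂ (y ∷ xs) h₁≤h₂ = +-mono-≤ (h₁≤h₂ y) (sumℕ-map-mono h₁ h₂ xs h₁≤h₂)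

∣i^k∣≡∣i∣^k : ∀ (i : ℤ) k → ∣ i ℤ.^ k ∣ ≡ ∣ i ∣ ^ k
∣i^k∣≡∣i∣^k i zero = refl
∣i^k∣≡∣i∣^k i (suc k) = ≡-trans (ℤP.abs-* i (i ℤ.^ k)) (cong (∣ i ∣ *_) (∣i^k∣≡∣i∣^k i k))

∣monoZ∣≡monoℕ : ∀ {d} (x : Fin d → ℤ) e → ∣ monoZ x e ∣ ≡ monoℕ (λ k → ∣ x k ∣) e
∣monoZ∣≡monoℕ x [] = refl
∣monoZ∣≡monoℕ x (e ∷ es) = ≡-trans (ℤP.abs-* (x Fin.zero ℤ.^ e) (monoZ (x ∘ Fin.suc) es))
                                  (cong₂ _*_ (∣i^k∣≡∣i∣^k (x Fin.zero) e) (∣monoZ∣≡monoℕ (x ∘ Fin.suc) es))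

module _ {d : ℕ} (x : Fin d → ℤ) where

  private
    contribution : Vec ℕ d → ℤ → Vec ℕ d → ℤ
    contribution e' c e with e' ≟ᵉ e
    ... | yes _ = c
    ... | no _ = + 0

    coef-∷ : ∀ c e' (q : ZPoly d) e → coef ((c , e') ∷ q) e ≡ contribution e' c e ℤ.+ coef q e
    coef-∷ c e' q e with e' ≟ᵉ e
    ... | yes _ = refl
    ... | no _ = sym (ℤP.+-identityˡ _)

    sum-contribution : ∀ c e' (D : List (Vec ℕ d)) → Unique D → e' ∈ D →
                       sumZ (map (λ e → contribution e' c e ℤ.* monoZ x e) D) ≡ c ℤ.* monoZ x e'
    sum-contribution c e' (_ ∷ D) (e'∉D ∷ _) (here refl) with e' ≟ᵉ e'
    ... | no e'≢e' = ⊥-elim (e'≢e' refl)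
    ... | yes _ = ≡-trans (cong (λ s → c ℤ.* monoZ x e' ℤ.+ s) (sumZ-map-zero _ D vanish)) (ℤP.+-identityʳ _)
      where
      vanish : ∀ e → e ∈ D → contribution e' c e ℤ.* monoZ x e ≡ + 0
      vanish e e∈D with e' ≟ᵉ e
      ... | yes e'≡e = ⊥-elim (All.lookup e'∉D e∈D e'≡e)
      ... | no _ = ℤP.*-zeroˡ (monoZ x e)
    sum-contribution c e' (e'' ∷ D) (e''∉D ∷ unique) (there e'∈D) with e' ≟ᵉ e''
    ... | yes refl = ⊥-elim (All.lookup e''∉D e'∈D refl)
    ... | no _ = ≡-trans (ℤP.+-identityˡ _) (sum-contribution c e' D unique e'∈D)

  evalZP≡sum-coef : ∀ (q : ZPoly d) (D : List (Vec ℕ d)) → Unique D → All (λ t → proj₂ t ∈ D) q →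
                    evalZP x q ≡ sumZ (map (λ e → coef q e ℤ.* monoZ x e) D)
  evalZP≡sum-coef [] D _ _ = sym (sumZ-map-zero _ D (λ _ _ → refl))
  evalZP≡sum-coef ((c , e') ∷ q) D unique (e'∈D ∷ covered) = sym (begin
      sumZ (map (λ e → coef ((c , e') ∷ q) e ℤ.* monoZ x e) D)
    ≡⟨ sumZ-map-cong D (λ e _ → ≡-trans (cong (ℤ._* monoZ x e) (coef-∷ c e' q e))
                                        (ℤP.*-distribʳ-+ (monoZ x e) (contribution e' c e) (coef q e))) ⟩
      sumZ (map (λ e → contribution e' c e ℤ.* monoZ x e ℤ.+ coef q e ℤ.* monoZ x e) D)
    ≡⟨ sumZ-map-+ (λ e → contribution e' c e ℤ.* monoZ x e) (λ e → coef q e ℤ.* monoZ x e) D ⟩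
      sumZ (map (λ e → contribution e' c e ℤ.* monoZ x e) D) ℤ.+ sumZ (map (λ e → coef q e ℤ.* monoZ x e) D)
    ≡⟨ cong₂ ℤ._+_ (sum-contribution c e' D unique e'∈D) (sym (evalZP≡sum-coef q D unique covered)) ⟩
      c ℤ.* monoZ x e' ℤ.+ evalZP x q
    ∎)
    where open ≡-Reasoning

  ∣evalZP∣≤sqcup : ∀ (qs : List (ZPoly d)) (q : ZPoly d) → q ∈ qs → ∣ evalZP x q ∣ ≤ sqcupℕ (λ k → ∣ x k ∣) qs
  ∣evalZP∣≤sqcup qs q q∈qs = begin
      ∣ evalZP x q ∣
    ≡⟨ cong ∣_∣ (evalZP≡sum-coef q (exponents qs) (UniqueP.deduplicate-! _≟ᵉ_ (concatMap (map proj₂) qs)) covered) ⟩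
      ∣ sumZ (map (λ e → coef q e ℤ.* monoZ x e) (exponents qs)) ∣
    ≤⟨ ∣sumZ-map∣≤ (λ e → coef q e ℤ.* monoZ x e) (exponents qs) ⟩
      foldr _+_ 0 (map (λ e → ∣ coef q e ℤ.* monoZ x e ∣) (exponents qs))
    ≤⟨ sumℕ-map-mono _ _ (exponents qs) term≤ ⟩
      sqcupℕ (λ k → ∣ x k ∣) qs
    ∎
    where
    open ≤-Reasoning
    covered : All (λ t → proj₂ t ∈ exponents qs) q
    covered = All.tabulate (λ t∈q → ∈-deduplicate⁺ _≟ᵉ_ (∈-concatMap⁺ (map proj₂) (lose q∈qs (∈-map⁺ proj₂ t∈q))))
    term≤ : ∀ e → ∣ coef q e ℤ.* monoZ x e ∣ ≤ maxCoef qs e * monoℕ (λ k → ∣ x k ∣) e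
    term≤ e = ≤-trans (≤-reflexive (≡-trans (ℤP.abs-* (coef q e) (monoZ x e)) (cong (∣ coef q e ∣ *_) (∣monoZ∣≡monoℕ x e))))
                      (*-monoˡ-≤ _ (∈⇒≤maxL-map (λ q' → ∣ coef q' e ∣) q∈qs))

-- Integers inside ℚ

↥toQ : ∀ z → ↥ (toQ z) ≡ z
↥toQ z = ≡-trans (sym (ℤP.*-identityʳ _)) (≡-trans (cong (λ w → ↥ (toQ z) ℤ.* + w) (sym (gcd-zeroʳ ℤ.∣ z ∣))) (ℚP.↥-/ z 1))

↧toQ : ∀ z → ↧ (toQ z) ≡ + 1
↧toQ z = ≡-trans (sym (ℤP.*-identityʳ _)) (≡-trans (cong (λ w → ↧ (toQ z) ℤ.* + w) (sym (gcd-zeroʳ ℤ.∣ z ∣))) (ℚP.↧-/ z 1))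

toQ-injective : ∀ a b → toQ a ≡ toQ b → a ≡ b
toQ-injective a b toQa≡toQb = ≡-trans (sym (↥toQ a)) (≡-trans (cong ↥_ toQa≡toQb) (↥toQ b))

-- In ℚᵘ the embedding z ↦ z/1 needs no normalisation, so toQ inherits its homomorphism laws from there.
private
  z/1 : ℤ → ℚᵘ.ℚᵘ
  z/1 z = ℚᵘ.mkℚᵘ z 0

  toℚᵘ-toQ : ∀ z → ℚ.toℚᵘ (toQ z) ℚᵘ.≃ z/1 z
  toℚᵘ-toQ z = ℚᵘ.*≡* (≡-trans (cong (ℤ._* + 1) (≡-trans (ℚP.↥ᵘ-toℚᵘ (toQ z)) (↥toQ z)))
                               (cong (z ℤ.*_) (sym (≡-trans (ℚP.↧ᵘ-toℚᵘ (toQ z)) (↧toQ z)))))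

  z/1-+ : ∀ a b → z/1 a ℚᵘ.+ z/1 b ℚᵘ.≃ z/1 (a ℤ.+ b)
  z/1-+ a b = ℚᵘ.*≡* (normalise a b)
    where
    normalise : ∀ a b → (a ℤ.* + 1 ℤ.+ b ℤ.* + 1) ℤ.* + 1 ≡ (a ℤ.+ b) ℤ.* + 1
    normalise = solveℤ

  z/1-* : ∀ a b → z/1 a ℚᵘ.* z/1 b ℚᵘ.≃ z/1 (a ℤ.* b)
  z/1-* a b = ℚᵘ.*≡* refl

toQ-+ : ∀ a b → toQ (a ℤ.+ b) ≡ toQ a ℚ.+ toQ b
toQ-+ a b = ℚP.toℚᵘ-injective (ℚᵘP.≃-trans (toℚᵘ-toQ (a ℤ.+ b)) (ℚᵘP.≃-sym
  (ℚᵘP.≃-trans (ℚP.toℚᵘ-homo-+ (toQ a) (toQ b)) (ℚᵘP.≃-trans (ℚᵘP.+-cong (toℚᵘ-toQ a) (toℚᵘ-toQ b)) (z/1-+ a b)))))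

toQ-* : ∀ a b → toQ (a ℤ.* b) ≡ toQ a ℚ.* toQ b
toQ-* a b = ℚP.toℚᵘ-injective (ℚᵘP.≃-trans (toℚᵘ-toQ (a ℤ.* b)) (ℚᵘP.≃-sym
  (ℚᵘP.≃-trans (ℚP.toℚᵘ-homo-* (toQ a) (toQ b)) (ℚᵘP.≃-trans (ℚᵘP.*-cong (toℚᵘ-toQ a) (toℚᵘ-toQ b)) (z/1-* a b)))))

evalPQ-toQ : ∀ {V : Set} (y : V → ℤ) p → evalPQ (toQ ∘ y) p ≡ toQ (evalP y p)
evalPQ-toQ y (pc c) = refl
evalPQ-toQ y (pv v) = refl
evalPQ-toQ y (p p+ q) = ≡-trans (cong₂ ℚ._+_ (evalPQ-toQ y p) (evalPQ-toQ y q)) (sym (toQ-+ (evalP y p) (evalP y q)))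
evalPQ-toQ y (p p* q) = ≡-trans (cong₂ ℚ._*_ (evalPQ-toQ y p) (evalPQ-toQ y q)) (sym (toQ-* (evalP y p) (evalP y q)))

evalPQ-cong : ∀ {V : Set} {σ τ : V → ℚ} → (∀ v → σ v ≡ τ v) → ∀ p → evalPQ σ p ≡ evalPQ τ p
evalPQ-cong σ≗τ (pc c) = refl
evalPQ-cong σ≗τ (pv v) = σ≗τ v
evalPQ-cong σ≗τ (p p+ q) = cong₂ ℚ._+_ (evalPQ-cong σ≗τ p) (evalPQ-cong σ≗τ q)
evalPQ-cong σ≗τ (p p* q) = cong₂ ℚ._*_ (evalPQ-cong σ≗τ p) (evalPQ-cong σ≗τ q)

powQ-toQ : ∀ a k → powQ (toQ a) k ≡ toQ (a ℤ.^ k)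
powQ-toQ a zero = refl
powQ-toQ a (suc k) = ≡-trans (cong (toQ a ℚ.*_) (powQ-toQ a k)) (sym (toQ-* a (a ℤ.^ k)))

monoQ-toQ : ∀ {d} (x : Fin d → ℤ) e → monoQ (toQ ∘ x) e ≡ toQ (monoZ x e)
monoQ-toQ x [] = refl
monoQ-toQ x (e ∷ es) = ≡-trans (cong₂ ℚ._*_ (powQ-toQ (x Fin.zero) e) (monoQ-toQ (x ∘ Fin.suc) es))
                               (sym (toQ-* (x Fin.zero ℤ.^ e) (monoZ (x ∘ Fin.suc) es)))

ScaledBy : ∀ {d} → ℚ → ℤ × Key d → ℚ × Key d → Set
ScaledBy L c q = proj₂ c ≡ proj₂ q × toQ (proj₁ c) ≡ L ℚ.* proj₁ q

module _ {d} (x : Fin d → ℤ) (n : ℕ) (L : ℚ) where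

  toQ-termZ : ∀ c q → ScaledBy L c q → toQ (termZ x n c) ≡ L ℚ.* termQ x n q
  toQ-termZ (c , e , a , b) (q , .e , .a , .b) (refl , c≡Lq) = begin
      toQ (c ℤ.* monoZ x e ℤ.* + nab n a b)
    ≡⟨ toQ-* (c ℤ.* monoZ x e) (+ nab n a b) ⟩
      toQ (c ℤ.* monoZ x e) ℚ.* toQ (+ nab n a b)
    ≡⟨ cong (ℚ._* toQ (+ nab n a b)) (≡-trans (toQ-* c (monoZ x e)) (cong₂ ℚ._*_ c≡Lq (sym (monoQ-toQ x e)))) ⟩
      L ℚ.* q ℚ.* monoQ (toQ ∘ x) e ℚ.* toQ (+ nab n a b)
    ≡⟨ cong (ℚ._* toQ (+ nab n a b)) (ℚP.*-assoc L q (monoQ (toQ ∘ x) e)) ⟩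
      L ℚ.* (q ℚ.* monoQ (toQ ∘ x) e) ℚ.* toQ (+ nab n a b)
    ≡⟨ ℚP.*-assoc L (q ℚ.* monoQ (toQ ∘ x) e) (toQ (+ nab n a b)) ⟩
      L ℚ.* termQ x n (q , e , a , b)
    ∎
    where open ≡-Reasoning

  toQ-sumZ : ∀ cs qs → Pointwise (ScaledBy L) cs qs → toQ (sumZ (map (termZ x n) cs)) ≡ L ℚ.* sumQ (map (termQ x n) qs)
  toQ-sumZ [] [] [] = sym (ℚP.*-zeroʳ L)
  toQ-sumZ (c ∷ cs) (q ∷ qs) (c~q ∷ cs~qs) =
    ≡-trans (toQ-+ (termZ x n c) (sumZ (map (termZ x n) cs)))
            (≡-trans (cong₂ ℚ._+_ (toQ-termZ c q c~q) (toQ-sumZ cs qs cs~qs))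
                     (sym (ℚP.*-distribˡ-+ L (termQ x n q) (sumQ (map (termQ x n) qs)))))

-- Stabilization

<⇒0<psub : ∀ a b → a ℤ.< b → + 0 ℤ.< b ℤ.+ (ℤ.- (+ 1)) ℤ.* a
<⇒0<psub a b a<b = subst (ℤ._< b ℤ.+ (ℤ.- (+ 1)) ℤ.* a) (cancel a) (ℤP.+-monoˡ-< ((ℤ.- (+ 1)) ℤ.* a) a<b)
  where
  cancel : ∀ a → a ℤ.+ (ℤ.- (+ 1)) ℤ.* a ≡ + 0
  cancel = solveℤ

0<psub⇒< : ∀ a b → + 0 ℤ.< b ℤ.+ (ℤ.- (+ 1)) ℤ.* a → a ℤ.< b
0<psub⇒< a b 0<b-a = subst₂ ℤ._<_ (ℤP.+-identityˡ a) (cancel a b) (ℤP.+-monoˡ-< a 0<b-a)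
  where
  cancel : ∀ a b → b ℤ.+ (ℤ.- (+ 1)) ℤ.* a ℤ.+ a ≡ b
  cancel = solveℤ

1≤lcm : ∀ a b → 1 ≤ a → 1 ≤ b → 1 ≤ lcm a b
1≤lcm a b 1≤a 1≤b with lcm a b ℕ.≟ 0
... | no lcm≢0 = n≢0⇒n>0 lcm≢0
... | yes lcm≡0 = ⊥-elim (<⇒≢ (*-mono-≤ 1≤a 1≤b)
                    (sym (≡-trans (sym (gcd*lcm a b)) (≡-trans (cong (gcd a b *_) lcm≡0) (*-zeroʳ (gcd a b))))))

1≤lcmDen : ∀ {d} (nf : List (ℚ × Key d)) → 1 ≤ lcmDen nf
1≤lcmDen [] = ≤-refl
1≤lcmDen (t ∷ nf) = 1≤lcm _ _ (s≤s z≤n) (1≤lcmDen nf)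

pointwise⇒all-related : ∀ {A B : Set} {R : A → B → Set} {xs ys} → Pointwise R xs ys → All (λ a → ∃[ y ] (y ∈ ys × R a y)) xs
pointwise⇒all-related [] = []
pointwise⇒all-related (r ∷ rs) = (_ , here refl , r) ∷ All.map (λ (y , y∈ , r') → y , there y∈ , r') (pointwise⇒all-related rs)

getAt∈take : ∀ {A : Set} (z : A) (xs : List A) j → 1 ≤ j → suc j ≤ length xs → getAt z xs j ∈ take (length xs ∸ 1) xs
getAt∈take z (x ∷ x' ∷ xs) (suc zero) _ _ = here refl
getAt∈take z (x ∷ x' ∷ xs) (suc (suc j)) _ (s≤s j+2≤) = there (getAt∈take z (x' ∷ xs) (suc j) (s≤s z≤n) j+2≤)
getAt∈take z (x ∷ []) (suc j) _ (s≤s ())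

some-tagged-or-none : ∀ tags → Any NotRest tags ⊎ All (_≡ rest) tags
some-tagged-or-none [] = inj₂ []
some-tagged-or-none (inΔ i j ∷ tags) = inj₁ (here tt)
some-tagged-or-none (inΓ i j ∷ tags) = inj₁ (here tt)
some-tagged-or-none (rest ∷ tags) with some-tagged-or-none tags
... | inj₁ some = inj₁ (there some)
... | inj₂ none = inj₂ (refl ∷ none)

zipWith-overTerm-rest : ∀ {d} {R : ℤ × Key d → Tag → Set} {lam tags} → Pointwise R lam tags → All (_≡ rest) tags →
                        zipWith overTerm lam tags ≡ lam
zipWith-overTerm-rest [] [] = refl
zipWith-overTerm-rest (_∷_ {x = t} _ rs) (refl ∷ none) = cong (t ∷_) (zipWith-overTerm-rest rs none)

base : ∀ {d} {A : Set} → A × Key d → ℕ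
base t = proj₂ (proj₂ (proj₂ t))

scaled-bases : ∀ {d L} {lam : List (ℤ × Key d)} {nf} →
               Pointwise (ScaledBy L) lam nf → All (λ t → 1 ≤ base t) nf → All (λ t → 1 ≤ base t) lam
scaled-bases [] [] = []
scaled-bases {L = L} ((key≡ , _) ∷ rs) (b ∷ bs) = subst (λ k → 1 ≤ proj₂ (proj₂ k)) (sym key≡) b ∷ scaled-bases {L = L} rs bs

-- Past the thresholds D_α, replacing n^a b^n by n^i j^n on Δ ∪ Γ can only increase npe_α.
module _ {d} (th : ℕ → ℕ × ℕ → ℕ × ℕ → ℕ) (th-ok : ThresholdFn th) (ψ' : Form (Fin d))
         (x : Fin d → ℤ) (x⊨ψ' : holds x ψ') (n : ℕ) where

  termZ≤overTerm : ∀ t tag → TagOK ψ' t tag → 1 ≤ base t → dTerm th t tag ≤ n → termZ x n t ℤ.≤ termZ x n (overTerm t tag)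
  termZ≤overTerm (c , e , a , b) (inΔ i j) (pos , ji>ba) 1≤b D≤n =
    ℤP.*-monoˡ-≤-nonNeg (c ℤ.* monoZ x e) {{ℤ.nonNegative (ℤP.<⇒≤ (pos x x⊨ψ'))}}
      (ℤ.+≤+ (<⇒≤ (subst (_< nab n i j) (+-identityʳ _)
                    (threshold-beyond th-ok 1 j i b a (≤-trans 1≤b (>lex⇒base-≥ ji>ba)) ji>ba n D≤n))))
  termZ≤overTerm (c , e , a , b) (inΓ i j) (nonpos , ba>ji) 1≤b D≤n =
    ℤP.*-monoˡ-≤-nonPos (c ℤ.* monoZ x e) {{ℤ.nonPositive (nonpos x x⊨ψ')}}
      (ℤ.+≤+ (<⇒≤ (subst (_< nab n a b) (+-identityʳ _) (threshold-beyond th-ok 1 b a j i 1≤b ba>ji n D≤n))))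
  termZ≤overTerm t rest _ _ _ = ℤP.≤-refl

  sum≤sum-overTerm : ∀ lam tags → Pointwise (TagOK ψ') lam tags → All (λ t → 1 ≤ base t) lam →
                     maxL 0 (zipWith (dTerm th) lam tags) ≤ n →
                     sumZ (map (termZ x n) lam) ℤ.≤ sumZ (map (termZ x n) (zipWith overTerm lam tags))
  sum≤sum-overTerm [] [] [] [] _ = ℤP.≤-refl
  sum≤sum-overTerm (t ∷ lam) (tag ∷ tags) (ok ∷ oks) (b ∷ bs) D≤n =
    ℤP.+-mono-≤ (termZ≤overTerm t tag ok b (≤-trans (m≤m⊔n _ _) D≤n))
                (sum≤sum-overTerm lam tags oks bs (≤-trans (m≤n⊔m _ _) D≤n))

module GroupedSign {d} (x : Fin d → ℤ) (grp : List (GTerm d))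
  (th : ℕ → ℕ × ℕ → ℕ × ℕ → ℕ) (th-ok : ThresholdFn th)
  (sorted : Linked (λ g h → gkey h >lex gkey g) grp)
  (P : ℕ) (coeff≤P : ∀ j → 1 ≤ j → suc j ≤ length grp → ∣ evalZP x (proj₁ (getAt ([] , 0 , 0) grp j)) ∣ ≤ P)
  (C : ℕ) (Cα≤C : Cα th (map gkey grp) ≤ C) where

  private
    ks = map gkey grp
    g : ℕ → GTerm d
    g = getAt ([] , 0 , 0) grp

    key≡ : ∀ j → keyAt ks j ≡ gkey (g j)
    key≡ = keyAt-map gkey ([] , 0 , 0) refl grp

  open SignStabilization th th-ok (length grp) (keyAt ks) (λ j → evalZP x (proj₁ (g j)))
    (λ i j 1≤i i<j j≤ℓ → subst₂ _>lex_ (sym (key≡ j)) (sym (key≡ i))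
       (linked⇒getAt (λ r s → >lex-trans s r) ([] , 0 , 0) sorted i j 1≤i i<j j≤ℓ))
    P coeff≤P C (≤-trans (1≤Cα th ks) Cα≤C)
    (subst (λ ℓ → ThresholdsBelow th (keyAt ks) ℓ C) (length-map gkey grp) (Cα-thresholdsBelow th ks Cα≤C))
    using (SignStable; partial-signStable; partial)

  private
    sum≡partial : ∀ n → sumZ (map (gTerm x n) grp) ≡ partial (length grp) n
    sum≡partial n = ≡-trans (sumZ-map≡sumTo ([] , 0 , 0) (gTerm x n) grp) (sumTo-cong term≡ (length grp))
      where
      term≡ : ∀ j → gTerm x n (g (suc j)) ≡ evalZP x (proj₁ (g (suc j))) ℤ.* + nab n (proj₂ (keyAt ks (suc j))) (proj₁ (keyAt ks (suc j)))
      term≡ j = cong (λ k → evalZP x (proj₁ (g (suc j))) ℤ.* + nab n (proj₂ k) (proj₁ k)) (sym (key≡ (suc j)))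

  grouped-signStable : SignStable (λ n → sumZ (map (gTerm x n) grp))
  grouped-signStable with partial-signStable (length grp) ≤-refl
  ... | inj₁ pos = inj₁ (λ n V≤n → subst (+ 0 ℤ.<_) (sym (sum≡partial n)) (pos n V≤n))
  ... | inj₂ nonpos = inj₂ (λ n V≤n → subst (ℤ._≤ + 0) (sym (sum≡partial n)) (nonpos n V≤n))

module Stabilization {d} (L : TLoop d) (sth : Bound (Fin d)) (sbp : IsStabBoundPoly L sth) (x : Fin d → ℤ) where
  open IsStabBoundPoly sbp
  open TLoop L using () renaming (pre to ψ; guard to φ; upd to η)

  ψ' : Form (Fin d)
  ψ' = ψ f∧ φ

  xₙ : ℕ → Fin d → ℤ
  xₙ n = iterUpd η n x

  ∣x∣ : Fin d → ℕ
  ∣x∣ k = ∣ x k ∣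

  P C V : ℕ
  P = sqcupℕ ∣x∣ Pol
  C = n₀ ⊔ (Cmax ⊔ Dmax)
  V = 2 * P + C

  evalB-sth : evalB ∣x∣ sth ≡ just V
  evalB-sth rewrite sth-eq | evalB-sqcup ∣x∣ Pol = refl

  StableFromV : Form (Fin d) → Set
  StableFromV φ' = ∀ n → V ≤ n → holds (xₙ V) φ' → holds (xₙ n) φ'

  module Atom (α : Poly (Fin d) × Poly (Fin d)) (I : AtomInfo d) (I∈infos : I ∈ infos) (ok : AtomOK L cf α I)
              (x⊨ψ' : holds x ψ') where
    open AtomInfo I
    open AtomOK ok using (nf-eq; lam-eq; nf-base; tags-ok; eventually; grp-sorted; grp-eq; over)

    diff : ℕ → ℤ
    diff n = evalP (xₙ n) (psub (proj₂ α) (proj₁ α))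

    npe : ℕ → ℤ
    npe n = sumZ (map (termZ x n) lam)

    npe‾ : ℕ → ℤ
    npe‾ n = sumZ (map (termZ x n) over)

    lc = lcmDen nf

    npe≡lc*diff : ∀ n → n₀ ≤ n → npe n ≡ + lc ℤ.* diff n
    npe≡lc*diff n n₀≤n = toQ-injective _ _ (begin
        toQ (npe n)
      ≡⟨ toQ-sumZ x n (toQ (+ lc)) lam nf lam-eq ⟩
        toQ (+ lc) ℚ.* sumQ (map (termQ x n) nf)
      ≡⟨ cong (toQ (+ lc) ℚ.*_) (nf-eq x n) ⟩
        toQ (+ lc) ℚ.* npeVal α cf x n
      ≡⟨ cong (toQ (+ lc) ℚ.*_) (≡-trans (evalPQ-cong (proj₂ cf-ok x n n₀≤n) (psub (proj₂ α) (proj₁ α)))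
                                         (evalPQ-toQ (xₙ n) (psub (proj₂ α) (proj₁ α)))) ⟩
        toQ (+ lc) ℚ.* toQ (diff n)
      ≡⟨ toQ-* (+ lc) (diff n) ⟨
        toQ (+ lc ℤ.* diff n)
      ∎)
      where open ≡-Reasoning

    0<npe⇒0<diff : ∀ n → n₀ ≤ n → + 0 ℤ.< npe n → + 0 ℤ.< diff n
    0<npe⇒0<diff n n₀≤n 0<npe = ℤP.*-cancelˡ-<-nonNeg (+ lc)
      (subst₂ ℤ._<_ (sym (ℤP.*-zeroʳ (+ lc))) (npe≡lc*diff n n₀≤n) 0<npe)

    0<diff⇒0<npe : ∀ n → n₀ ≤ n → + 0 ℤ.< diff n → + 0 ℤ.< npe n
    0<diff⇒0<npe n n₀≤n 0<diff = subst₂ ℤ._<_ (ℤP.*-zeroʳ (+ lc)) (sym (npe≡lc*diff n n₀≤n))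
      (ℤP.*-monoˡ-<-pos (+ lc) {{ℤ.positive (ℤ.+<+ (1≤lcmDen nf))}} 0<diff)

    n₀≤V : n₀ ≤ V
    n₀≤V = ≤-trans (m≤m⊔n n₀ _) (m≤n+m C (2 * P))

    npe≤npe‾ : ∀ n → V ≤ n → npe n ℤ.≤ npe‾ n
    npe≤npe‾ n V≤n = sum≤sum-overTerm th th-ok ψ' x x⊨ψ' n lam tags tags-ok (scaled-bases {L = toQ (+ lc)} lam-eq nf-base)
      (≤-trans Dα≤Dmax (≤-trans (m≤n⊔m Cmax Dmax) (≤-trans (m≤n⊔m n₀ _) (≤-trans (m≤n+m C (2 * P)) V≤n))))
      where
      Dα≤Dmax : maxL 0 (zipWith (dTerm th) lam tags) ≤ Dmax
      Dα≤Dmax = ∈⇒≤maxL-map (λ I → maxL 0 (zipWith (dTerm th) (AtomInfo.lam I) (AtomInfo.tags I))) I∈infos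

    coeff≤P : ∀ j → 1 ≤ j → suc j ≤ length grp → ∣ evalZP x (proj₁ (getAt ([] , 0 , 0) grp j)) ∣ ≤ P
    coeff≤P j 1≤j j<ℓ = ∣evalZP∣≤sqcup x Pol (proj₁ (getAt ([] , 0 , 0) grp j)) (∈-concatMap⁺ _ (lose I∈infos
      (subst (proj₁ (getAt ([] , 0 , 0) grp j) ∈_) (sym (take-map (length grp ∸ 1) grp)) (∈-map⁺ proj₁ (getAt∈take ([] , 0 , 0) grp j 1≤j j<ℓ)))))

    Cα≤C : Cα th (map gkey grp) ≤ C
    Cα≤C = ≤-trans (∈⇒≤maxL-map (λ I → Cα th (map gkey (AtomInfo.grp I))) I∈infos)
                   (≤-trans (m≤m⊔n Cmax Dmax) (m≤n⊔m n₀ _))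

    open GroupedSign x grp th th-ok grp-sorted P coeff≤P C Cα≤C using (grouped-signStable)

    atom-stable : StableFromV (proj₁ α f< proj₂ α)
    atom-stable n V≤n holds-at-V = 0<psub⇒< _ _ (0<npe⇒0<diff n (≤-trans n₀≤V V≤n) (npe-positive n V≤n))
      where
      0<npe‾V : + 0 ℤ.< npe‾ V
      0<npe‾V = ℤP.<-≤-trans (0<diff⇒0<npe V n₀≤V (<⇒0<psub _ _ holds-at-V)) (npe≤npe‾ V ≤-refl)
      npe‾-positive : ∀ n → V ≤ n → + 0 ℤ.< npe‾ n
      npe‾-positive with grouped-signStable
      ... | inj₁ pos = λ n V≤n → subst (+ 0 ℤ.<_) (grp-eq x n) (pos n V≤n)
      ... | inj₂ nonpos = ⊥-elim (ℤP.<-irrefl refl (ℤP.<-≤-trans 0<npe‾V (subst (ℤ._≤ + 0) (grp-eq x V) (nonpos V ≤-refl))))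
      -- If npe‾_α ≠ npe_α, it is eventually non-positive, which contradicts positivity from V on.
      npe-positive : ∀ n → V ≤ n → + 0 ℤ.< npe n
      npe-positive with some-tagged-or-none tags
      ... | inj₁ some = let N , nonpos = eventually some x x⊨ψ' in
        ⊥-elim (ℤP.<-irrefl refl (ℤP.<-≤-trans (npe‾-positive (V ⊔ N) (m≤m⊔n V N)) (nonpos (V ⊔ N) (m≤n⊔m V N))))
      ... | inj₂ none = λ n V≤n →
        subst (λ l → + 0 ℤ.< sumZ (map (termZ x n) l)) (zipWith-overTerm-rest tags-ok none) (npe‾-positive n V≤n)

  holds-stable : ∀ φ' → All (λ α → StableFromV (proj₁ α f< proj₂ α)) (atoms φ') → StableFromV φ'
  holds-stable (p f< q) (stable ∷ []) = stable
  holds-stable (φ₁ f∧ φ₂) stable n V≤n (h₁ , h₂) =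
    holds-stable φ₁ (AllP.++⁻ˡ (atoms φ₁) stable) n V≤n h₁ , holds-stable φ₂ (AllP.++⁻ʳ (atoms φ₁) stable) n V≤n h₂
  holds-stable (φ₁ f∨ φ₂) stable n V≤n (inj₁ h) = inj₁ (holds-stable φ₁ (AllP.++⁻ˡ (atoms φ₁) stable) n V≤n h)
  holds-stable (φ₁ f∨ φ₂) stable n V≤n (inj₂ h) = inj₂ (holds-stable φ₂ (AllP.++⁻ʳ (atoms φ₁) stable) n V≤n h)

  guard-stable : holds x ψ' → StableFromV φ
  guard-stable x⊨ψ' = holds-stable φ (All.map (λ {α} (I , I∈infos , ok) → Atom.atom-stable α I I∈infos ok x⊨ψ')
                                                (pointwise⇒all-related infos-ok))

  -- If the guard held at the first V + 1 iterates, it would hold forever.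
  run-length≤sth : ¬ InfiniteRun L → holds x ψ → ∀ K → (∀ k → k < K → holds (xₙ k) φ) → K ≤∞ evalB ∣x∣ sth
  run-length≤sth finite x⊨ψ K guards rewrite evalB-sth with K ≤? V
  ... | yes K≤V = ≤j K≤V
  ... | no K≰V = ⊥-elim (finite (x , x⊨ψ , always))
    where
    V<K : V < K
    V<K = ≰⇒> K≰V
    always : ∀ n → holds (xₙ n) φ
    always n with n <? K
    ... | yes n<K = guards n n<K
    ... | no n≮K = guard-stable (x⊨ψ , guards 0 (≤-trans (s≤s z≤n) V<K)) n (≤-trans (<⇒≤ V<K) (≮⇒≥ n≮K)) (guards V V<K)

-- Local runtime bounds

0≤∞ : ∀ E → 0 ≤∞ E
0≤∞ nothing = ≤ω
0≤∞ (just v) = ≤j z≤n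

1+-≤∞ : ∀ {k E} → k ≤∞ E → suc k ≤∞ lift2 _+_ (just 1) E
1+-≤∞ ≤ω = ≤ω
1+-≤∞ (≤j k≤v) = ≤j (s≤s k≤v)

1+[2*h+1]-≤∞ : ∀ {k h E} → h ≤∞ E → k ≤ suc (h + h) → suc k ≤∞ lift2 _+_ (just 1) (lift2 _+_ (lift2 _*_ (just 2) E) (just 1))
1+[2*h+1]-≤∞ ≤ω _ = ≤ω
1+[2*h+1]-≤∞ {k} {h} (≤j {v} h≤v) k≤2h+1 = ≤j (s≤s (begin
  k                 ≤⟨ k≤2h+1 ⟩
  suc (h + h)       ≤⟨ s≤s (+-mono-≤ h≤v h≤v) ⟩
  suc (v + v)       ≡⟨ cong (λ w → suc (v + w)) (+-identityʳ v) ⟨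
  suc (v + (v + 0)) ≡⟨ +-comm 1 (v + (v + 0)) ⟩
  v + (v + 0) + 1   ∎))
  where open ≤-Reasoning

halve : ∀ n → ∃[ h ] (h + h ≤ n × n ≤ suc (h + h))
halve n with even-or-odd n
... | h , inj₁ refl = h , ≤-refl , n≤1+n (h + h)
... | h , inj₂ refl = h , n≤1+n (h + h) , ≤-refl

guards-⋆L : ∀ {d} (L : TLoop d) x h → (∀ k → k < h + h → holds (iterUpd (TLoop.upd L) k x) (TLoop.guard L)) →
            ∀ k → k < h → holds (iterUpd (TLoop.upd (L ⋆L L)) k x) (TLoop.guard (L ⋆L L))
guards-⋆L L x h guards k k<h =
    coerce (sym (holds-cong (iterUpd-twice η k x) φ)) (guards (k + k) (<-trans (n<1+n (k + k)) 2k+1<2h))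
  , coerce (sym (≡-trans (holds-substF η _ φ) (holds-cong (λ j → evalP-cong (iterUpd-twice η k x) (η j)) φ)))
           (guards (suc (k + k)) 2k+1<2h)
  where
  open TLoop L using () renaming (guard to φ; upd to η)
  2k+1<2h : suc (k + k) < h + h
  2k+1<2h = ≤-trans (≤-reflexive (cong suc (sym (+-suc k k)))) (+-mono-≤ k<h k<h)

module _ (P : Program) (C : SimpleCycle P) {r : Trans (m P) (nL P)} {e : InE P C r} (ch : Choice P C r e) where
  open SimpleCycle C using (ℓ)
  open Choice ch
  open Cycle P C

  -- Via cycleRun⇒guards, a bound on the iterations of L bounds the rounds through the cycle.
  RunBound : Bound (Fin d) → Set
  RunBound B = ∀ x → holds x ψ → ∀ K → (∀ k → k < K → holds (iterUpd ηL k x) φL) → suc K ≤∞ evalB (λ k → ∣ x k ∣) B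

  runBound⇒isLocalBound : ∀ B → RunBound B → IsLocalBound P C r (back B)
  runBound⇒isLocalBound B bound j σ₀ ℓ'' σ ℓ' σ' k reach rounds =
    subst (k ≤∞_) (sym (evalB-mapB (λ k → π ⟨$⟩ˡ ι k) (λ v → ∣ σ (inj₁ v) ∣) B)) (count k rounds)
    where
    at-i : ℓ'' ≡ ℓ (InE.i e)
    at-i = let (_ , _ , _ , tgt≡ , _) = reach in ≡-trans (sym tgt≡) (InE.r-tgt e)
    count : ∀ k → RelPow (UpTo j) k (ℓ'' , σ) (ℓ' , σ') → k ≤∞ evalB (λ k → ∣ loopVars ch σ k ∣) B
    count zero _ = 0≤∞ _
    count (suc k) power =
      let s , run , k*[n+1]<s = upTo-power⇒cycleRun j k {ℓ'' , σ} {ℓ' , σ'} (InE.i e) at-i power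
      in bound (loopVars ch σ) (ψ-reach σ₀ σ (subst (λ z → ReachVia P r σ₀ z σ) at-i reach)) k
               (cycleRun⇒guards ch k s (<⇒≤ k*[n+1]<s) run at-i)

  tnn-runBound : ∀ sth → IsStabBoundPoly L sth → Terminating (loopProgram L) → RunBound (bn 1 b+ sth)
  tnn-runBound sth sbp terminates x x⊨ψ K guards =
    1+-≤∞ (Stabilization.run-length≤sth L sth sbp x (terminating⇒¬infiniteRun L terminates) x⊨ψ K guards)

  twn-runBound : ∀ sth → IsStabBoundPoly (L ⋆L L) sth → Terminating (loopProgram L) → RunBound (bn 1 b+ ((bn 2 b* sth) b+ bn 1))
  twn-runBound sth sbp terminates x x⊨ψ K guards =
    let h , 2h≤K , K≤2h+1 = halve K in
    1+[2*h+1]-≤∞ (Stabilization.run-length≤sth (L ⋆L L) sth sbp x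
                 (terminating⇒¬infiniteRun L terminates ∘ infiniteRun-⋆L L) x⊨ψ h
                 (guards-⋆L L x h (λ k k<2h → guards k (<-≤-trans k<2h 2h≤K))))
               K≤2h+1

theorem31 : (P : Program) (C : SimpleCycle P) (r : Trans (m P) (nL P)) (e : InE P C r)
            (b : Bound (Fin (m P))) → AlgOutput P C r e b → IsLocalBound P C r b
theorem31 P C r e .bω (no-shape _) _ _ _ _ _ _ _ _ _ = ≤ω
theorem31 P C r e .bω (nonterm-case _ _) _ _ _ _ _ _ _ _ _ = ≤ω
theorem31 P C r e _ (tnn-case ch _ terminates sth sbp) =
  runBound⇒isLocalBound P C ch (bn 1 b+ sth) (tnn-runBound P C ch sth sbp terminates)
theorem31 P C r e _ (twn-case ch _ terminates sth sbp) =
  runBound⇒isLocalBound P C ch (bn 1 b+ ((bn 2 b* sth) b+ bn 1)) (twn-runBound P C ch sth sbp terminates)
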